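{- Let $n\ge1$ be an integer not divisible by $3$. There is a unique bijection $\phi$ from the set of $(3,n)$-Dyck paths to itself such that for every $(3,n)$-Dyck path $\Pi$: $\operatorname{area}(\phi(\Pi))=\operatorname{dinv}(\Pi)$, $\operatorname{dinv}(\phi(\Pi))=\operatorname{area}(\Pi)$, and $\operatorname{skip}(\phi(\Pi))=\operatorname{skip}(\Pi)$.
   Context: A $(3,n)$-Dyck path is a lattice path from $(0,0)$ to $(3,n)$ using unit north and east steps that stays weakly above the line $y=\frac{n}{3}x$. The cell $(a,b)$ ($a\in\{1,2,3\}$ column from left, $b\in\{1,\dots,n\}$ row from bottom) is $[a-1,a]\times[b-1,b]$. For a path $\Pi$, $\lambda(\Pi)$ is the set of cells lying above (north-west of) $\Pi$. $\operatorname{area}(\Pi)$ is the number of cells lying entirely below $\Pi$ and above the line $y=\frac n3x$. For $x\in\lambda(\Pi)$, $\operatorname{arm}(x)$ (resp. $\operatorname{leg}(x)$) is the number of cells of $\lambda(\Pi)$ strictly east (resp. strictly south) of $x$ in its row (resp. column). $\operatorname{dinv}(\Pi)$ is the number of $x\in\lambda(\Pi)$ with $\frac{\operatorname{arm}(x)}{\operatorname{leg}(x)+1}<\frac{3}{n}<\frac{\operatorname{arm}(x)+1}{\operatorname{leg}(x)}$ (right side $+\infty$ if $\operatorname{leg}(x)=0$). The rank of cell $(a,b)$ is $-an+3(b-1)$. The rank word of $\Pi$ is the list of all positive ranks of cells (these lie in columns 1 and 2 and are distinct) written in increasing order, where each entry whose cell lies in $\lambda(\Pi)$ is marked ("boxed").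 A skip of $\Pi$ is a maximal block of consecutive unboxed entries of the rank word that has at least one boxed entry somewhere to its left and at least one boxed entry somewhere to its right; $\operatorname{skip}(\Pi)$ is the number of skips. -}

module Defs where

open import Data.Bool using (Bool; true; false; T; _∧_; not; if_then_else_)
open import Data.Nat using (ℕ; zero; suc; _+_; _*_; _∸_; _≤ᵇ_; _<ᵇ_; _≡ᵇ_; _≤_)
open import Data.List using (List; []; _∷_; length; filterᵇ; concatMap; map; upTo)
open import Data.Product using (Σ; _×_; _,_; proj₁; ∃)
open import Relation.Binary.PropositionalEquality using (_≡_)
open import Relation.Nullary using (¬_)
open import Function.Definitions using (Bijective)

data Step : Set where
  N E : Step

countN : List Step → ℕ
countN []      = 0
countN (N ∷ p) = suc (countN p)
countN (E ∷ p) = countN p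

countE : List Step → ℕ
countE []      = 0
countE (N ∷ p) = countE p
countE (E ∷ p) = suc (countE p)

-- aboveLine n x y p : starting at lattice point (x,y), every lattice point
-- visited by p satisfies y' ≥ (n/3) x', i.e. n * x' ≤ 3 * y'.
-- (Segments are straight, so checking the visited lattice points suffices.)
aboveLine : ℕ → ℕ → ℕ → List Step → Bool
aboveLine n x y []      = true
aboveLine n x y (N ∷ p) = (n * x ≤ᵇ 3 * suc y) ∧ aboveLine n x (suc y) p
aboveLine n x y (E ∷ p) = (n * suc x ≤ᵇ 3 * y) ∧ aboveLine n (suc x) y p

isDyck : ℕ → List Step → Bool
isDyck n p = (countE p ≡ᵇ 3) ∧ ((countN p ≡ᵇ n) ∧ aboveLine n 0 0 p)

-- The set of (3,n)-Dyck paths (the Bool-valued predicate makes the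
-- proof component proof-irrelevant, so _≡_ is equality of paths).
DyckPath : ℕ → Set
DyckPath n = Σ (List Step) (λ p → T (isDyck n p))

-- Cells.  Cell (a,b) = [a-1,a] × [b-1,b], a ∈ {1,2,3}, b ∈ {1..n}.

-- heightBefore p a : number of North steps taken before the a-th East
-- step (a ≥ 1), i.e. the height of the path along column a.
heightBefore : List Step → ℕ → ℕ
heightBefore []      a                   = 0
heightBefore (N ∷ p) a                   = suc (heightBefore p a)
heightBefore (E ∷ p) zero                = 0
heightBefore (E ∷ p) (suc zero)          = 0
heightBefore (E ∷ p) (suc (suc a))       = heightBefore p (suc a)

columns : List ℕ
columns = 1 ∷ 2 ∷ 3 ∷ []

cells : ℕ → List (ℕ × ℕ)
cells n = concatMap (λ a → map (λ k → (a , suc k)) (upTo n)) columns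

countWhere : {A : Set} → (A → Bool) → List A → ℕ
countWhere f xs = length (filterᵇ f xs)

-- cell (a,b) ∈ λ(Π): lies above (north-west of) the path
inLam : List Step → ℕ → ℕ → Bool
inLam p a b = heightBefore p a <ᵇ b

-- area: cells entirely below the path (b ≤ height of column a) and
-- entirely above the line (its lowest-rightmost corner (a,b-1) satisfies
-- n * a ≤ 3 * (b-1)).
area : (n : ℕ) → DyckPath n → ℕ
area n (p , _) =
  countWhere (λ { (a , b) → (b ≤ᵇ heightBefore p a) ∧ (n * a ≤ᵇ 3 * (b ∸ 1)) })
             (cells n)

arm : ℕ → List Step → ℕ → ℕ → ℕ
arm n p a b = countWhere (λ a' → (a <ᵇ a') ∧ inLam p a' b) columns

leg : ℕ → List Step → ℕ → ℕ → ℕ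
leg n p a b = countWhere (λ b' → (b' <ᵇ b) ∧ inLam p a b') (map suc (upTo n))

-- arm/(leg+1) < 3/n < (arm+1)/leg   (right side = +∞ when leg = 0),
-- cross-multiplied (all denominators positive).
dinvCond : ℕ → ℕ → ℕ → Bool
dinvCond n ar lg =
  (n * ar <ᵇ 3 * suc lg) ∧ rightCond lg
  where
    rightCond : ℕ → Bool
    rightCond zero       = true
    rightCond (suc l)    = 3 * suc l <ᵇ n * suc ar

dinv : (n : ℕ) → DyckPath n → ℕ
dinv n (p , _) =
  countWhere (λ { (a , b) → inLam p a b ∧ dinvCond n (arm n p a b) (leg n p a b) })
             (cells n)

-- Ranks.  rank(a,b) = -a n + 3(b-1); it is positive iff a n < 3(b-1),
-- and then equals 3(b-1) ∸ a n.

-- The rank word: positive ranks r listed in increasing order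
-- (r = 1, 2, …, 3n covers all positive ranks), each entry recorded as
-- true iff ("boxed") its cell lies in λ(Π).
rankWord : (n : ℕ) → DyckPath n → List Bool
rankWord n (p , _) =
  concatMap
    (λ r → map (λ { (a , b) → inLam p a b })
               (filterᵇ (λ { (a , b) → (a * n <ᵇ 3 * (b ∸ 1))
                                       ∧ (3 * (b ∸ 1) ≡ᵇ a * n + r) })
                        (cells n)))
    (map suc (upTo (3 * n)))

-- Number of maximal blocks of consecutive unboxed (false) entries having a
-- boxed entry somewhere to the left and somewhere to the right.
-- seen = a boxed entry occurred earlier; gap = we are inside an unboxed block.
skipsAux : Bool → Bool → List Bool → ℕ
skipsAux seen gap []           = 0
skipsAux seen gap (true ∷ w)   = (if seen ∧ gap then 1 else 0) + skipsAux true false w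
skipsAux seen gap (false ∷ w)  = skipsAux seen true w

skip : (n : ℕ) → DyckPath n → ℕ
skip n Π = skipsAux false false (rankWord n Π)

Swaps : (n : ℕ) → (DyckPath n → DyckPath n) → Set
Swaps n φ = ∀ Π → (area n (φ Π) ≡ dinv n Π)
                × (dinv n (φ Π) ≡ area n Π)
                × (skip n (φ Π) ≡ skip n Π)

-- Write n = 3K+1+e with e ∈ {0,1}. A (3,n)-Dyck path has three columns, so it is determined by
-- the numbers u, v of cells of its first two columns lying between the path and the line
-- y = n x / 3. In these coordinates the rank word is an interleaving of two monotone Boolean
-- sequences, one per column, and the (u, v)-plane splits into three regions on each of which
-- area = u + v, dinv and skip are affine. One reads off that area + dinv + skip = 3K + e, that
-- skip ≤ area and skip ≤ dinv, that (dinv, skip) determines the path, and that every pair (d, s)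
-- with s ≤ d and 2s + d ≤ 3K + e occurs. Hence the set of triples (area, dinv, skip) is invariant
-- under exchanging area and dinv, and since (dinv, skip) determines a path, the bijection is forced:
-- φ Π is the path with dinv = area Π and skip = skip Π, and φ is an involution.

module Submission where

open import Defs
open import Data.Nat using (ℕ; _≤_)
open import Data.Nat.Divisibility using (_∣_)
open import Data.Product using (Σ; _×_)
open import Relation.Binary.PropositionalEquality using (_≡_)
open import Relation.Nullary using (¬_)
open import Function.Definitions using (Bijective)

open import Data.Bool using (Bool; true; false; T; _∧_; if_then_else_)
open import Data.Bool.Properties using (T-irrelevant; ∧-zeroʳ; ∧-identityʳ)
open import Data.Empty using (⊥-elim)
open import Data.List using (List; []; _∷_; _++_; map; upTo; applyUpTo; concatMap; filterᵇ; replicate)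
open import Data.List.Properties using (map-upTo; ++-assoc; ++-identityʳ; filter-++; map-++)
open import Data.Nat
open import Data.Nat.DivMod using (_%_; _/_; m≡m%n+[m/n]*n; m%n<n)
open import Data.Nat.Divisibility using (divides)
open import Data.Nat.Properties
open import Data.Nat.Tactic.RingSolver using (solve-∀)
open import Data.Product using (_,_; proj₁; proj₂)
open import Data.Sum using (_⊎_; inj₁; inj₂)
open import Data.Unit using (tt)
open import Function using (_∘_)
open import Function.Definitions using (Injective; Surjective)
open import Relation.Binary.PropositionalEquality
open import Relation.Nullary using (yes; no)


T-ext : ∀ {x y : Bool} → (T x → T y) → (T y → T x) → x ≡ y
T-ext {false} {false} _ _ = refl
T-ext {false} {true}  _ g = ⊥-elim (g tt)
T-ext {true}  {false} f _ = ⊥-elim (f tt)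
T-ext {true}  {true}  _ _ = refl

T-∧⁻ : ∀ x {y} → T (x ∧ y) → T x × T y
T-∧⁻ true t = tt , t

T-∧⁺ : ∀ {x y} → T x → T y → T (x ∧ y)
T-∧⁺ {true} _ t = t

T⇒≡true : ∀ {x} → T x → x ≡ true
T⇒≡true {true} _ = refl

¬T⇒≡false : ∀ {x} → ¬ T x → x ≡ false
¬T⇒≡false {false} _ = refl
¬T⇒≡false {true}  f = ⊥-elim (f tt)

<⇒<ᵇ≡true : ∀ {m n} → m < n → (m <ᵇ n) ≡ true
<⇒<ᵇ≡true = T⇒≡true ∘ <⇒<ᵇ

≥⇒<ᵇ≡false : ∀ {m n} → n ≤ m → (m <ᵇ n) ≡ false
≥⇒<ᵇ≡false {m} {n} n≤m = ¬T⇒≡false (λ t → <⇒≱ (<ᵇ⇒< m n t) n≤m)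

≤⇒≤ᵇ≡true : ∀ {m n} → m ≤ n → (m ≤ᵇ n) ≡ true
≤⇒≤ᵇ≡true = T⇒≡true ∘ ≤⇒≤ᵇ

>⇒≤ᵇ≡false : ∀ {m n} → n < m → (m ≤ᵇ n) ≡ false
>⇒≤ᵇ≡false {m} {n} n<m = ¬T⇒≡false (λ t → <⇒≱ n<m (≤ᵇ⇒≤ m n t))

≡⇒≡ᵇ≡true : ∀ {m n} → m ≡ n → (m ≡ᵇ n) ≡ true
≡⇒≡ᵇ≡true {m} {n} = T⇒≡true ∘ ≡⇒≡ᵇ m n

≢⇒≡ᵇ≡false : ∀ {m n} → m ≢ n → (m ≡ᵇ n) ≡ false
≢⇒≡ᵇ≡false {m} {n} m≢n = ¬T⇒≡false (m≢n ∘ ≡ᵇ⇒≡ m n)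

+-<ᵇ-cancelˡ : ∀ k m n → (k + m <ᵇ k + n) ≡ (m <ᵇ n)
+-<ᵇ-cancelˡ zero    m n = refl
+-<ᵇ-cancelˡ (suc k) m n = +-<ᵇ-cancelˡ k m n

<ᵇ-suc : ∀ m n → (m <ᵇ suc n) ≡ (m ≤ᵇ n)
<ᵇ-suc zero    n = refl
<ᵇ-suc (suc m) n = refl

+-≤ᵇ-cancelˡ : ∀ k m n → (k + m ≤ᵇ k + n) ≡ (m ≤ᵇ n)
+-≤ᵇ-cancelˡ zero    m n = refl
+-≤ᵇ-cancelˡ (suc k) m n = trans (<ᵇ-suc (k + m) (k + n)) (+-≤ᵇ-cancelˡ k m n)

m+k≡n⇒m≤n : ∀ {m n} k → m + k ≡ n → m ≤ n
m+k≡n⇒m≤n {m} k refl = m≤m+n m k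

indicator : Bool → ℕ
indicator b = if b then 1 else 0

count : (ℕ → Bool) → ℕ → ℕ
count P zero    = 0
count P (suc m) = indicator (P 0) + count (P ∘ suc) m

countWhere-∷ : ∀ {A : Set} (P : A → Bool) x xs →
  countWhere P (x ∷ xs) ≡ indicator (P x) + countWhere P xs
countWhere-∷ P x xs with P x
... | true  = refl
... | false = refl

countWhere-++ : ∀ {A : Set} (P : A → Bool) xs ys →
  countWhere P (xs ++ ys) ≡ countWhere P xs + countWhere P ys
countWhere-++ P []       ys = refl
countWhere-++ P (x ∷ xs) ys = begin
  countWhere P (x ∷ xs ++ ys)                            ≡⟨ countWhere-∷ P x (xs ++ ys) ⟩
  indicator (P x) + countWhere P (xs ++ ys)              ≡⟨ cong (indicator (P x) +_) (countWhere-++ P xs ys) ⟩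
  indicator (P x) + (countWhere P xs + countWhere P ys)  ≡⟨ +-assoc (indicator (P x)) _ _ ⟨
  indicator (P x) + countWhere P xs + countWhere P ys    ≡⟨ cong (_+ countWhere P ys) (countWhere-∷ P x xs) ⟨
  countWhere P (x ∷ xs) + countWhere P ys                ∎
  where open ≡-Reasoning

countWhere-applyUpTo : ∀ {A : Set} (P : A → Bool) (f : ℕ → A) m →
  countWhere P (applyUpTo f m) ≡ count (P ∘ f) m
countWhere-applyUpTo P f zero    = refl
countWhere-applyUpTo P f (suc m) =
  trans (countWhere-∷ P (f 0) (applyUpTo (f ∘ suc) m))
        (cong (indicator (P (f 0)) +_) (countWhere-applyUpTo P (f ∘ suc) m))

countWhere-map-upTo : ∀ {A : Set} (P : A → Bool) (f : ℕ → A) m →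
  countWhere P (map f (upTo m)) ≡ count (P ∘ f) m
countWhere-map-upTo P f m = trans (cong (countWhere P) (map-upTo f m)) (countWhere-applyUpTo P f m)

count-cong : ∀ P Q m → (∀ i → i < m → P i ≡ Q i) → count P m ≡ count Q m
count-cong P Q zero    _  = refl
count-cong P Q (suc m) eq =
  cong₂ _+_ (cong indicator (eq 0 z<s)) (count-cong (P ∘ suc) (Q ∘ suc) m (λ i i<m → eq (suc i) (s<s i<m)))

count-+ : ∀ P a b → count P (a + b) ≡ count P a + count (λ i → P (a + i)) b
count-+ P zero    b = refl
count-+ P (suc a) b =
  trans (cong (indicator (P 0) +_) (count-+ (P ∘ suc) a b)) (sym (+-assoc (indicator (P 0)) _ _))

count-all : ∀ P m → (∀ i → i < m → P i ≡ true) → count P m ≡ m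
count-all P zero    _   = refl
count-all P (suc m) all rewrite all 0 z<s =
  cong suc (count-all (P ∘ suc) m (λ i i<m → all (suc i) (s<s i<m)))

count-none : ∀ P m → (∀ i → i < m → P i ≡ false) → count P m ≡ 0
count-none P zero    _    = refl
count-none P (suc m) none rewrite none 0 z<s =
  count-none (P ∘ suc) m (λ i i<m → none (suc i) (s<s i<m))

count-window : ∀ P lo m hi →
  (∀ i → i < lo → P i ≡ false) →
  (∀ i → i < m → P (lo + i) ≡ true) →
  (∀ i → i < hi → P (lo + (m + i)) ≡ false) →
  count P (lo + (m + hi)) ≡ m
count-window P lo m hi below inside above = begin
  count P (lo + (m + hi))                                   ≡⟨ count-+ P lo (m + hi) ⟩
  count P lo + count (λ i → P (lo + i)) (m + hi)            ≡⟨ cong₂ _+_ (count-none P lo below) (count-+ _ m hi) ⟩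
  count (λ i → P (lo + i)) m + count (λ i → P (lo + (m + i))) hi
    ≡⟨ cong₂ _+_ (count-all _ m inside) (count-none _ hi above) ⟩
  m + 0                                                     ≡⟨ +-identityʳ m ⟩
  m                                                         ∎
  where open ≡-Reasoning

concatUpTo : {A : Set} → (ℕ → List A) → ℕ → List A
concatUpTo B zero    = []
concatUpTo B (suc m) = B 0 ++ concatUpTo (B ∘ suc) m

rep : {A : Set} → ℕ → List A → List A
rep m c = concatUpTo (λ _ → c) m

concatUpTo-+ : ∀ {A : Set} (B : ℕ → List A) a b →
  concatUpTo B (a + b) ≡ concatUpTo B a ++ concatUpTo (λ i → B (a + i)) b
concatUpTo-+ B zero    b = refl
concatUpTo-+ B (suc a) b =
  trans (cong (B 0 ++_) (concatUpTo-+ (B ∘ suc) a b)) (sym (++-assoc (B 0) _ _))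

concatUpTo-cong : ∀ {A : Set} (B C : ℕ → List A) m →
  (∀ i → i < m → B i ≡ C i) → concatUpTo B m ≡ concatUpTo C m
concatUpTo-cong B C zero    _  = refl
concatUpTo-cong B C (suc m) eq =
  cong₂ _++_ (eq 0 z<s) (concatUpTo-cong (B ∘ suc) (C ∘ suc) m (λ i i<m → eq (suc i) (s<s i<m)))

concatUpTo-runs₂ : ∀ {A : Set} (B : ℕ → List A) x y (c₁ c₂ : List A) →
  (∀ i → i < x → B i ≡ c₁) → (∀ i → i < y → B (x + i) ≡ c₂) →
  concatUpTo B (x + y) ≡ rep x c₁ ++ rep y c₂
concatUpTo-runs₂ B x y c₁ c₂ run₁ run₂ =
  trans (concatUpTo-+ B x y) (cong₂ _++_ (concatUpTo-cong _ _ x run₁) (concatUpTo-cong _ _ y run₂))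

concatUpTo-runs : ∀ {A : Set} (B : ℕ → List A) x y z (c₁ c₂ c₃ : List A) →
  (∀ i → i < x → B i ≡ c₁) →
  (∀ i → i < y → B (x + i) ≡ c₂) →
  (∀ i → i < z → B (x + (y + i)) ≡ c₃) →
  concatUpTo B (x + (y + z)) ≡ rep x c₁ ++ rep y c₂ ++ rep z c₃
concatUpTo-runs B x y z c₁ c₂ c₃ run₁ run₂ run₃ = trans (concatUpTo-+ B x (y + z))
  (cong₂ _++_ (concatUpTo-cong _ _ x run₁) (concatUpTo-runs₂ (λ i → B (x + i)) y z c₂ c₃ run₂ run₃))

concatMap-upTo-suc : ∀ {A : Set} (f : ℕ → List A) m →
  concatMap f (map suc (upTo m)) ≡ concatUpTo (f ∘ suc) m
concatMap-upTo-suc f m = trans (cong (concatMap f) (map-upTo suc m)) (go suc m)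
  where
  go : ∀ (g : ℕ → ℕ) m → concatMap f (applyUpTo g m) ≡ concatUpTo (f ∘ g) m
  go g zero    = refl
  go g (suc m) = cong (f (g 0) ++_) (go (g ∘ suc) m)

concatUpTo-triples : ∀ {A : Set} (B : ℕ → List A) m →
  concatUpTo B (3 * m) ≡ concatUpTo (λ j → B (3 * j) ++ B (1 + 3 * j) ++ B (2 + 3 * j)) m
concatUpTo-triples B zero    = refl
concatUpTo-triples B (suc m) = begin
  concatUpTo B (3 * suc m)
    ≡⟨ cong (concatUpTo B) (*-suc 3 m) ⟩
  B 0 ++ B 1 ++ B 2 ++ concatUpTo (λ i → B (3 + i)) (3 * m)
    ≡⟨ cong (λ w → B 0 ++ B 1 ++ B 2 ++ w) (concatUpTo-triples (λ i → B (3 + i)) m) ⟩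
  B 0 ++ B 1 ++ B 2 ++ concatUpTo (λ j → B (3 + 3 * j) ++ B (4 + 3 * j) ++ B (5 + 3 * j)) m
    ≡⟨ cong (λ w → B 0 ++ B 1 ++ B 2 ++ w)
         (concatUpTo-cong _ _ m (λ j _ → cong (λ k → B k ++ B (1 + k) ++ B (2 + k)) (sym (*-suc 3 j)))) ⟩
  B 0 ++ B 1 ++ B 2 ++ concatUpTo (λ j → B (3 * suc j) ++ B (1 + 3 * suc j) ++ B (2 + 3 * suc j)) m
    ≡⟨ trans (++-assoc (B 0) _ _) (cong (B 0 ++_) (++-assoc (B 1) _ _)) ⟨
  (B 0 ++ B 1 ++ B 2) ++ concatUpTo (λ j → B (3 * suc j) ++ B (1 + 3 * suc j) ++ B (2 + 3 * suc j)) m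
    ∎
  where open ≡-Reasoning


-- Paths with three east steps

northRuns : ℕ → ℕ → ℕ → ℕ → List Step
northRuns a b c d = replicate a N ++ E ∷ replicate b N ++ E ∷ replicate c N ++ E ∷ replicate d N

colPath : ℕ → ℕ → ℕ → List Step
colPath a b c = northRuns a b c 0

heightBefore-north : ∀ a r x → heightBefore (replicate a N ++ r) x ≡ a + heightBefore r x
heightBefore-north zero    r x = refl
heightBefore-north (suc a) r x = cong suc (heightBefore-north a r x)

height₁ : ∀ a b c → heightBefore (colPath a b c) 1 ≡ a
height₁ a b c = trans (heightBefore-north a _ 1) (+-identityʳ a)

height₂ : ∀ a b c → heightBefore (colPath a b c) 2 ≡ a + b
height₂ a b c = trans (heightBefore-north a _ 2) (cong (a +_) (trans (heightBefore-north b _ 1) (+-identityʳ b)))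

height₃ : ∀ a b c → heightBefore (colPath a b c) 3 ≡ a + (b + c)
height₃ a b c = trans (heightBefore-north a _ 3)
  (cong (a +_) (trans (heightBefore-north b _ 2) (cong (b +_) (trans (heightBefore-north c _ 1) (+-identityʳ c)))))

countE-north : ∀ a r → countE (replicate a N ++ r) ≡ countE r
countE-north zero    r = refl
countE-north (suc a) r = countE-north a r

countN-north : ∀ a r → countN (replicate a N ++ r) ≡ a + countN r
countN-north zero    r = refl
countN-north (suc a) r = cong suc (countN-north a r)

countN-northRuns : ∀ a b c d → countN (northRuns a b c d) ≡ a + (b + (c + d))
countN-northRuns a b c d = trans (countN-north a _)
  (cong (a +_) (trans (countN-north b _) (cong (b +_) (trans (countN-north c _) (cong (c +_) (countN-replicate d))))))
  where
  countN-replicate : ∀ d → countN (replicate d N) ≡ d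
  countN-replicate zero    = refl
  countN-replicate (suc d) = cong suc (countN-replicate d)

countE-colPath : ∀ a b c → countE (colPath a b c) ≡ 3
countE-colPath a b c = trans (countE-north a _) (cong suc (trans (countE-north b _) (cong suc (countE-north c _))))

splitAtE : ∀ p m → countE p ≡ suc m → Σ ℕ λ a → Σ (List Step) λ q → p ≡ replicate a N ++ E ∷ q × countE q ≡ m
splitAtE []      m ()
splitAtE (E ∷ p) m eq = 0 , p , refl , suc-injective eq
splitAtE (N ∷ p) m eq with splitAtE p m eq
... | a , q , refl , eq′ = suc a , q , refl , eq′

noE⇒north : ∀ p → countE p ≡ 0 → p ≡ replicate (countN p) N
noE⇒north []      _  = refl
noE⇒north (N ∷ p) eq = cong (N ∷_) (noE⇒north p eq)

threeE⇒northRuns : ∀ p → countE p ≡ 3 →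
  Σ ℕ λ a → Σ ℕ λ b → Σ ℕ λ c → Σ ℕ λ d → p ≡ northRuns a b c d
threeE⇒northRuns p eq with splitAtE p 2 eq
... | a , p₁ , refl , eq₁ with splitAtE p₁ 1 eq₁
... | b , p₂ , refl , eq₂ with splitAtE p₂ 0 eq₂
... | c , p₃ , refl , eq₃ = a , b , c , countN p₃ ,
  cong (λ r → replicate a N ++ E ∷ replicate b N ++ E ∷ replicate c N ++ E ∷ r) (noE⇒north p₃ eq₃)

aboveLine-north⁻ : ∀ n x y a r → T (aboveLine n x y (replicate a N ++ r)) → T (aboveLine n x (a + y) r)
aboveLine-north⁻ n x y zero    r t = t
aboveLine-north⁻ n x y (suc a) r t =
  subst (λ z → T (aboveLine n x z r)) (+-suc a y)
        (aboveLine-north⁻ n x (suc y) a r (proj₂ (T-∧⁻ (n * x ≤ᵇ 3 * suc y) t)))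

aboveLine-north⁺ : ∀ n x y a r → n * x ≤ 3 * y → T (aboveLine n x (a + y) r) → T (aboveLine n x y (replicate a N ++ r))
aboveLine-north⁺ n x y zero    r _     t = t
aboveLine-north⁺ n x y (suc a) r below t = T-∧⁺ (≤⇒≤ᵇ below′)
  (aboveLine-north⁺ n x (suc y) a r below′ (subst (λ z → T (aboveLine n x z r)) (sym (+-suc a y)) t))
  where
  below′ : n * x ≤ 3 * suc y
  below′ = ≤-trans below (*-monoʳ-≤ 3 (n≤1+n y))

aboveLine-northRuns : ∀ n a b c d → T (aboveLine n 0 0 (northRuns a b c d)) →
  (n * 1 ≤ 3 * a) × (n * 2 ≤ 3 * (a + b)) × (n * 3 ≤ 3 * (a + (b + c)))
aboveLine-northRuns n a b c d t =
  subst (λ y → n * 1 ≤ 3 * y) (+-identityʳ a) (≤ᵇ⇒≤ _ _ (proj₁ run₁)) ,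
  subst (λ y → n * 2 ≤ 3 * y) (eq₂ a b) (≤ᵇ⇒≤ _ _ (proj₁ run₂)) ,
  subst (λ y → n * 3 ≤ 3 * y) (eq₃ a b c) (≤ᵇ⇒≤ _ _ (proj₁ run₃))
  where
  run₁ = T-∧⁻ (n * 1 ≤ᵇ 3 * (a + 0)) (aboveLine-north⁻ n 0 0 a _ t)
  run₂ = T-∧⁻ (n * 2 ≤ᵇ 3 * (b + (a + 0))) (aboveLine-north⁻ n 1 (a + 0) b _ (proj₂ run₁))
  run₃ = T-∧⁻ (n * 3 ≤ᵇ 3 * (c + (b + (a + 0)))) (aboveLine-north⁻ n 2 (b + (a + 0)) c _ (proj₂ run₂))
  eq₂ : ∀ a b → b + (a + 0) ≡ a + b
  eq₂ = solve-∀
  eq₃ : ∀ a b c → c + (b + (a + 0)) ≡ a + (b + c)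
  eq₃ = solve-∀

colPath-aboveLine : ∀ n a b c → n * 1 ≤ 3 * a → n * 2 ≤ 3 * (a + b) → n * 3 ≤ 3 * (a + (b + c)) →
  T (aboveLine n 0 0 (colPath a b c))
colPath-aboveLine n a b c above₁ above₂ above₃ =
  aboveLine-north⁺ n 0 0 a _ (≤-reflexive (*-zeroʳ n))
    (T-∧⁺ (≤⇒≤ᵇ above₁′) (aboveLine-north⁺ n 1 (a + 0) b _ above₁′
    (T-∧⁺ (≤⇒≤ᵇ above₂′) (aboveLine-north⁺ n 2 (b + (a + 0)) c _ above₂′
    (T-∧⁺ (≤⇒≤ᵇ above₃′) tt)))))
  where
  above₁′ : n * 1 ≤ 3 * (a + 0)
  above₁′ = subst (λ y → n * 1 ≤ 3 * y) (sym (+-identityʳ a)) above₁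
  above₂′ : n * 2 ≤ 3 * (b + (a + 0))
  above₂′ = subst (λ y → n * 2 ≤ 3 * y) (eq₂ a b) above₂
    where eq₂ : ∀ a b → a + b ≡ b + (a + 0) ; eq₂ = solve-∀
  above₃′ : n * 3 ≤ 3 * (c + (b + (a + 0)))
  above₃′ = subst (λ y → n * 3 ≤ 3 * y) (eq₃ a b c) above₃
    where eq₃ : ∀ a b c → a + (b + c) ≡ c + (b + (a + 0)) ; eq₃ = solve-∀

threshold⁻ : ∀ {t x k} → 3 * t < x → x ≤ 3 * k → t < k
threshold⁻ {t} {x} {k} 3t<x x≤3k = *-cancelˡ-< 3 t k (<-≤-trans 3t<x x≤3k)

threshold⁺ : ∀ {t x k} → x ≤ 3 * suc t → t < k → x ≤ 3 * k
threshold⁺ x≤3t+3 t<k = ≤-trans x≤3t+3 (*-monoʳ-≤ 3 t<k)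

threshold : ∀ {t x} → 3 * t < x → x ≤ 3 * suc t → ∀ k → (x ≤ᵇ 3 * k) ≡ (suc t ≤ᵇ k)
threshold {t} {x} lower upper k = T-ext
  (λ le → ≤⇒≤ᵇ (threshold⁻ {t} {x} {k} lower (≤ᵇ⇒≤ x (3 * k) le)))
  (λ lt → ≤⇒≤ᵇ (threshold⁺ upper (≤ᵇ⇒≤ (suc t) k lt)))

below-threshold : ∀ {t x} → 3 * t < x → x ≤ 3 * suc t → ∀ m → (3 * m <ᵇ x) ≡ (m ≤ᵇ t)
below-threshold {t} {x} lower upper m = T-ext
  (λ lt → ≤⇒≤ᵇ (≤-pred (*-cancelˡ-< 3 m (suc t) (<-≤-trans (<ᵇ⇒< (3 * m) x lt) upper))))
  (λ le → <⇒<ᵇ (≤-<-trans (*-monoʳ-≤ 3 (≤ᵇ⇒≤ m t le)) lower))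

strict-threshold : ∀ {t x} → 3 * t < x → x < 3 * suc t → ∀ k → (x <ᵇ 3 * suc k) ≡ (t ≤ᵇ k)
strict-threshold {t} {x} lower upper k = T-ext
  (λ lt → ≤⇒≤ᵇ {t} (≤-pred (threshold⁻ {t} {x} {suc k} lower (<⇒≤ (<ᵇ⇒< x (3 * suc k) lt)))))
  (λ le → <⇒<ᵇ (<-≤-trans upper (*-monoʳ-≤ 3 (s≤s (≤ᵇ⇒≤ t k le)))))

-- The line y = n x / 3, n = 3K+1+e, passes strictly between heights K and K+1 at x = 1
-- and between 2K+e and 2K+e+1 at x = 2.
module Line (K e : ℕ) (e≤1 : e ≤ 1) where

  line₁-lower : 3 * K < (3 * K + 1 + e) * 1
  line₁-lower = m+k≡n⇒m≤n e (eq K e)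
    where eq : ∀ K e → suc (3 * K) + e ≡ (3 * K + 1 + e) * 1 ; eq = solve-∀

  line₁-upper : (3 * K + 1 + e) * 1 < 3 * suc K
  line₁-upper = upper e≤1
    where
    upper : ∀ {e} → e ≤ 1 → (3 * K + 1 + e) * 1 < 3 * suc K
    upper z≤n       = m+k≡n⇒m≤n 1 (eq K) where eq : ∀ K → suc ((3 * K + 1 + 0) * 1) + 1 ≡ 3 * suc K ; eq = solve-∀
    upper (s≤s z≤n) = m+k≡n⇒m≤n 0 (eq K) where eq : ∀ K → suc ((3 * K + 1 + 1) * 1) + 0 ≡ 3 * suc K ; eq = solve-∀

  line₂-lower : 3 * (2 * K + e) < (3 * K + 1 + e) * 2
  line₂-lower = lower e≤1
    where
    lower : ∀ {e} → e ≤ 1 → 3 * (2 * K + e) < (3 * K + 1 + e) * 2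
    lower z≤n       = m+k≡n⇒m≤n 1 (eq K) where eq : ∀ K → suc (3 * (2 * K + 0)) + 1 ≡ (3 * K + 1 + 0) * 2 ; eq = solve-∀
    lower (s≤s z≤n) = m+k≡n⇒m≤n 0 (eq K) where eq : ∀ K → suc (3 * (2 * K + 1)) + 0 ≡ (3 * K + 1 + 1) * 2 ; eq = solve-∀

  line₂-upper : (3 * K + 1 + e) * 2 ≤ 3 * suc (2 * K + e)
  line₂-upper = m+k≡n⇒m≤n (1 + e) (eq K e)
    where eq : ∀ K e → (3 * K + 1 + e) * 2 + (1 + e) ≡ 3 * suc (2 * K + e) ; eq = solve-∀

  dinvCond-arm₀ : ∀ j → dinvCond (3 * K + 1 + e) 0 j ≡ (j ≤ᵇ K)
  dinvCond-arm₀ zero    = cong (λ x → (x <ᵇ 3) ∧ true) (*-zeroʳ (3 * K + 1 + e))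
  dinvCond-arm₀ (suc l) =
    trans (cong (λ x → (x <ᵇ 3 * suc (suc l)) ∧ (3 * suc l <ᵇ (3 * K + 1 + e) * 1)) (*-zeroʳ (3 * K + 1 + e)))
          (below-threshold line₁-lower (<⇒≤ line₁-upper) (suc l))

  dinvCond-arm₁ : ∀ j → j < 2 * K + e → dinvCond (3 * K + 1 + e) 1 j ≡ (K ≤ᵇ j)
  dinvCond-arm₁ zero    _ = trans (∧-identityʳ _) (strict-threshold line₁-lower line₁-upper 0)
  dinvCond-arm₁ (suc l) l<2K+e =
    trans (cong₂ _∧_ (strict-threshold line₁-lower line₁-upper (suc l))
                     (<⇒<ᵇ≡true (<-trans (*-monoʳ-< 3 l<2K+e) line₂-lower)))
          (∧-identityʳ _)

-- colPath a b c is a path of size n = 3K+1+e with u resp. v cells of its first resp. second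
-- column between the path and the line y = n x / 3.
record Columns (K e a b c u v : ℕ) : Set where
  field
    col₁ : a ≡ suc K + u
    col₂ : a + b ≡ suc (2 * K + e) + v
    col₃ : v + c ≡ K

  n≡col₂ : 3 * K + 1 + e ≡ suc (2 * K + e) + (v + c)
  n≡col₂ = trans (eq K e) (cong (suc (2 * K + e) +_) (sym col₃))
    where eq : ∀ K e → 3 * K + 1 + e ≡ suc (2 * K + e) + K ; eq = solve-∀

  total : a + (b + c) ≡ 3 * K + 1 + e
  total = begin
    a + (b + c)                ≡⟨ +-assoc a b c ⟨
    a + b + c                  ≡⟨ cong (_+ c) col₂ ⟩
    suc (2 * K + e) + v + c    ≡⟨ +-assoc (suc (2 * K + e)) v c ⟩
    suc (2 * K + e) + (v + c)  ≡⟨ n≡col₂ ⟨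
    3 * K + 1 + e              ∎
    where open ≡-Reasoning

  n≡col₁ : 3 * K + 1 + e ≡ suc K + (u + (b + c))
  n≡col₁ = trans (sym total) (trans (cong (_+ (b + c)) col₁) (+-assoc (suc K) u (b + c)))

  b+c≤2K+e : b + c ≤ 2 * K + e
  b+c≤2K+e = +-cancelˡ-≤ (suc K) _ _ (m+k≡n⇒m≤n u (begin
    suc K + (b + c) + u    ≡⟨ reorder K b c u ⟩
    suc K + (u + (b + c))  ≡⟨ n≡col₁ ⟨
    3 * K + 1 + e          ≡⟨ split K e ⟩
    suc K + (2 * K + e)    ∎))
    where
    open ≡-Reasoning
    reorder : ∀ K b c u → suc K + (b + c) + u ≡ suc K + (u + (b + c))
    reorder = solve-∀
    split : ∀ K e → 3 * K + 1 + e ≡ suc K + (2 * K + e)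
    split = solve-∀

module Decomposition (K e : ℕ) (e≤1 : e ≤ 1) where

  open Line K e e≤1

  private
    n : ℕ
    n = 3 * K + 1 + e

  dyck⇒columns : ∀ p → T (isDyck n p) →
    Σ ℕ λ a → Σ ℕ λ b → Σ ℕ λ c → Σ ℕ λ u → Σ ℕ λ v → p ≡ colPath a b c × Columns K e a b c u v
  dyck⇒columns p t
    with threeE⇒northRuns p (≡ᵇ⇒≡ _ 3 (proj₁ (T-∧⁻ (countE p ≡ᵇ 3) t)))
  ... | a , b , c , d , refl = a , b , c , u , v , cong (northRuns a b c) d≡0 , record
    { col₁ = sym (proj₂ (m≤n⇒∃[o]m+o≡n K<a)) ; col₂ = sym (proj₂ (m≤n⇒∃[o]m+o≡n 2K+e<a+b)) ; col₃ = v+c≡K }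
    where
    sizes = T-∧⁻ (countN (northRuns a b c d) ≡ᵇ n) (proj₂ (T-∧⁻ (countE (northRuns a b c d) ≡ᵇ 3) t))
    a+b+c+d≡n : a + (b + (c + d)) ≡ n
    a+b+c+d≡n = trans (sym (countN-northRuns a b c d)) (≡ᵇ⇒≡ _ n (proj₁ sizes))
    above = aboveLine-northRuns n a b c d (proj₂ sizes)
    d≡0 : d ≡ 0
    d≡0 = n≤0⇒n≡0 (+-cancelˡ-≤ (a + (b + c)) d 0 (begin
      a + (b + c) + d    ≡⟨ reorder a b c d ⟩
      a + (b + (c + d))  ≡⟨ a+b+c+d≡n ⟩
      n                  ≤⟨ *-cancelˡ-≤ 3 (subst (_≤ 3 * (a + (b + c))) (*-comm n 3) (proj₂ (proj₂ above))) ⟩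
      a + (b + c)        ≡⟨ +-identityʳ _ ⟨
      a + (b + c) + 0    ∎))
      where
      open ≤-Reasoning
      reorder : ∀ a b c d → a + (b + c) + d ≡ a + (b + (c + d))
      reorder = solve-∀
    K<a : suc K ≤ a
    K<a = threshold⁻ line₁-lower (proj₁ above)
    2K+e<a+b : suc (2 * K + e) ≤ a + b
    2K+e<a+b = threshold⁻ line₂-lower (proj₁ (proj₂ above))
    u = proj₁ (m≤n⇒∃[o]m+o≡n K<a)
    v = proj₁ (m≤n⇒∃[o]m+o≡n 2K+e<a+b)
    v+c≡K : v + c ≡ K
    v+c≡K = +-cancelˡ-≡ (suc (2 * K + e)) _ _ (begin
      suc (2 * K + e) + (v + c)   ≡⟨ +-assoc (suc (2 * K + e)) v c ⟨
      suc (2 * K + e) + v + c     ≡⟨ cong (_+ c) (proj₂ (m≤n⇒∃[o]m+o≡n 2K+e<a+b)) ⟩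
      a + b + c                   ≡⟨ +-identityʳ _ ⟨
      a + b + c + 0               ≡⟨ cong (a + b + c +_) d≡0 ⟨
      a + b + c + d               ≡⟨ reorder a b c d ⟩
      a + (b + (c + d))           ≡⟨ a+b+c+d≡n ⟩
      3 * K + 1 + e               ≡⟨ split K e ⟩
      suc (2 * K + e) + K         ∎)
      where
      open ≡-Reasoning
      reorder : ∀ a b c d → a + b + c + d ≡ a + (b + (c + d))
      reorder = solve-∀
      split : ∀ K e → 3 * K + 1 + e ≡ suc (2 * K + e) + K
      split = solve-∀

  columns⇒dyck : ∀ {a b c u v} → Columns K e a b c u v → T (isDyck n (colPath a b c))
  columns⇒dyck {a} {b} {c} {u} {v} cols =
    T-∧⁺ (≡⇒≡ᵇ _ 3 (countE-colPath a b c))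
    (T-∧⁺ (≡⇒≡ᵇ _ n (trans (countN-northRuns a b c 0) (trans (cong (λ x → a + (b + x)) (+-identityʳ c)) total)))
    (colPath-aboveLine n a b c
      (threshold⁺ (<⇒≤ line₁-upper) (m+k≡n⇒m≤n u (sym col₁)))
      (threshold⁺ line₂-upper (m+k≡n⇒m≤n v (sym col₂)))
      (≤-reflexive (trans (*-comm n 3) (cong (3 *_) (sym total))))))
    where open Columns cols


-- Area and dinv of a three-column path

column : ℕ → ℕ → List (ℕ × ℕ)
column n x = map (λ k → (x , suc k)) (upTo n)

countWhere-cells : ∀ (P : ℕ × ℕ → Bool) n → countWhere P (cells n) ≡
  count (λ k → P (1 , suc k)) n + (count (λ k → P (2 , suc k)) n + count (λ k → P (3 , suc k)) n)
countWhere-cells P n = begin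
  countWhere P (column n 1 ++ column n 2 ++ column n 3 ++ [])
    ≡⟨ countWhere-++ P (column n 1) _ ⟩
  countWhere P (column n 1) + countWhere P (column n 2 ++ column n 3 ++ [])
    ≡⟨ cong (countWhere P (column n 1) +_) (countWhere-++ P (column n 2) _) ⟩
  countWhere P (column n 1) + (countWhere P (column n 2) + countWhere P (column n 3 ++ []))
    ≡⟨ cong₂ _+_ (in-column 1) (cong₂ _+_ (in-column 2)
         (trans (countWhere-++ P (column n 3) []) (trans (+-identityʳ _) (in-column 3)))) ⟩
  count (λ k → P (1 , suc k)) n + (count (λ k → P (2 , suc k)) n + count (λ k → P (3 , suc k)) n)
    ∎
  where
  open ≡-Reasoning
  in-column : ∀ x → countWhere P (column n x) ≡ count (λ k → P (x , suc k)) n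
  in-column x = countWhere-map-upTo P (λ k → (x , suc k)) n

area-column : ∀ n p x lo d hi → heightBefore p x ≡ lo + d → n ≡ lo + (d + hi) →
  (∀ k → (n * x ≤ᵇ 3 * k) ≡ (lo ≤ᵇ k)) →
  count (λ k → (suc k ≤ᵇ heightBefore p x) ∧ (n * x ≤ᵇ 3 * k)) n ≡ d
area-column n p x lo d hi height n≡ line = begin
  count (λ k → (suc k ≤ᵇ heightBefore p x) ∧ (n * x ≤ᵇ 3 * k)) n
    ≡⟨ count-cong _ P n (λ k _ → cong₂ (λ h l → (suc k ≤ᵇ h) ∧ l) height (line k)) ⟩
  count P n
    ≡⟨ cong (count P) n≡ ⟩
  count P (lo + (d + hi))
    ≡⟨ count-window P lo d hi
         (λ i i<lo → trans (cong ((suc i ≤ᵇ lo + d) ∧_) (>⇒≤ᵇ≡false i<lo)) (∧-zeroʳ _))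
         (λ i i<d → cong₂ _∧_ (≤⇒≤ᵇ≡true (+-monoʳ-< lo i<d)) (≤⇒≤ᵇ≡true (m≤m+n lo i)))
         (λ i _ → cong (_∧ (lo ≤ᵇ lo + (d + i))) (>⇒≤ᵇ≡false (s≤s (+-monoʳ-≤ lo (m≤m+n d i))))) ⟩
  d ∎
  where
  open ≡-Reasoning
  P : ℕ → Bool
  P k = (suc k ≤ᵇ lo + d) ∧ (lo ≤ᵇ k)

inLam-row : ∀ p x k {h} → heightBefore p x ≡ h → inLam p x (suc k) ≡ (h ≤ᵇ k)
inLam-row p x k {h} hx = trans (cong (_<ᵇ suc k) hx) (<ᵇ-suc h k)

leg-above : ∀ n p x {h} j r → heightBefore p x ≡ h → n ≡ h + (j + r) → leg n p x (suc (h + j)) ≡ j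
leg-above n p x {h} j r hx n≡ = begin
  leg n p x (suc (h + j))
    ≡⟨ countWhere-map-upTo _ suc n ⟩
  count P n
    ≡⟨ cong (count P) n≡ ⟩
  count P (h + (j + r))
    ≡⟨ count-window P h j r
         (λ i i<h → trans (cong ((suc i <ᵇ suc (h + j)) ∧_) (trans (inLam-row p x i hx) (>⇒≤ᵇ≡false i<h))) (∧-zeroʳ _))
         (λ i i<j → cong₂ _∧_ (<⇒<ᵇ≡true (+-monoʳ-< h i<j))
                              (trans (inLam-row p x (h + i) hx) (≤⇒≤ᵇ≡true (m≤m+n h i))))
         (λ i _ → cong (_∧ inLam p x (suc (h + (j + i)))) (≥⇒<ᵇ≡false (+-monoʳ-≤ h (m≤m+n j i)))) ⟩
  j ∎
  where
  open ≡-Reasoning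
  P : ℕ → Bool
  P i = (suc i <ᵇ suc (h + j)) ∧ inLam p x (suc i)

arm₁ : ∀ n p r x → inLam p 2 r ≡ x → inLam p 3 r ≡ false → arm n p 1 r ≡ indicator x
arm₁ n p r false in₂ in₃ rewrite in₂ | in₃ = refl
arm₁ n p r true  in₂ in₃ rewrite in₂ | in₃ = refl

arm₂ : ∀ n p r → inLam p 3 r ≡ false → arm n p 2 r ≡ 0
arm₂ n p r in₃ rewrite in₃ = refl

module ColumnStatistics {K e : ℕ} (e≤1 : e ≤ 1) {a b c u v : ℕ} (cols : Columns K e a b c u v) where

  open Line K e e≤1
  open Columns cols

  private
    n : ℕ
    n = 3 * K + 1 + e
    p : List Step
    p = colPath a b c

  area-columns : ∀ t → area n (p , t) ≡ u + v
  area-columns t = trans (countWhere-cells _ n) (trans (cong₂ _+_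
    (area-column n p 1 (suc K) u (b + c) (trans (height₁ a b c) col₁) n≡col₁ (threshold line₁-lower (<⇒≤ line₁-upper)))
    (cong₂ _+_
      (area-column n p 2 (suc (2 * K + e)) v c (trans (height₂ a b c) col₂) n≡col₂ (threshold line₂-lower line₂-upper))
      (count-none _ n (λ k k<n → trans (cong ((suc k ≤ᵇ heightBefore p 3) ∧_)
        (>⇒≤ᵇ≡false (subst (3 * k <_) (*-comm 3 n) (*-monoʳ-< 3 k<n)))) (∧-zeroʳ _)))))
    (cong (u +_) (+-identityʳ v)))

  private
    dinvCondAt dinvCell : ℕ → ℕ → Bool
    dinvCondAt x k = dinvCond n (arm n p x (suc k)) (leg n p x (suc k))
    dinvCell x k = inLam p x (suc k) ∧ dinvCondAt x k

    in₁ : ∀ k → inLam p 1 (suc k) ≡ (a ≤ᵇ k)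
    in₁ k = inLam-row p 1 k (height₁ a b c)

    in₂ : ∀ k → inLam p 2 (suc k) ≡ (a + b ≤ᵇ k)
    in₂ k = inLam-row p 2 k (height₂ a b c)

    out₃ : ∀ k → k < n → inLam p 3 (suc k) ≡ false
    out₃ k k<n = trans (inLam-row p 3 k (trans (height₃ a b c) total)) (>⇒≤ᵇ≡false k<n)

  dinvCell₁-lower : ∀ j → j < b → dinvCell 1 (a + j) ≡ (j ≤ᵇ K)
  dinvCell₁-lower j j<b = begin
    dinvCell 1 (a + j)
      ≡⟨ cong₂ (λ x y → x ∧ dinvCond n y (leg n p 1 (suc (a + j))))
           (trans (in₁ (a + j)) (≤⇒≤ᵇ≡true (m≤m+n a j)))
           (arm₁ n p (suc (a + j)) false (trans (in₂ (a + j)) (>⇒≤ᵇ≡false (+-monoʳ-< a j<b)))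
             (out₃ (a + j) (subst (a + j <_) total (+-monoʳ-< a (<-≤-trans j<b (m≤m+n b c)))))) ⟩
    dinvCond n 0 (leg n p 1 (suc (a + j)))
      ≡⟨ cong (dinvCond n 0) (leg-above n p 1 j (b ∸ j + c) (height₁ a b c)
           (sym (trans (cong (a +_) (trans (sym (+-assoc j (b ∸ j) c)) (cong (_+ c) (m+[n∸m]≡n (<⇒≤ j<b))))) total))) ⟩
    dinvCond n 0 j
      ≡⟨ dinvCond-arm₀ j ⟩
    (j ≤ᵇ K) ∎
    where open ≡-Reasoning

  dinvCell₁-upper : ∀ i → i < c → dinvCell 1 (a + (b + i)) ≡ (K ≤ᵇ b + i)
  dinvCell₁-upper i i<c = begin
    dinvCell 1 (a + (b + i))
      ≡⟨ cong₂ (λ x y → x ∧ dinvCond n y (leg n p 1 (suc (a + (b + i)))))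
           (trans (in₁ (a + (b + i))) (≤⇒≤ᵇ≡true (m≤m+n a (b + i))))
           (arm₁ n p (suc (a + (b + i))) true (trans (in₂ (a + (b + i))) (≤⇒≤ᵇ≡true (+-monoʳ-≤ a (m≤m+n b i))))
             (out₃ (a + (b + i)) (subst (a + (b + i) <_) total (+-monoʳ-< a (+-monoʳ-< b i<c))))) ⟩
    dinvCond n 1 (leg n p 1 (suc (a + (b + i))))
      ≡⟨ cong (dinvCond n 1) (leg-above n p 1 (b + i) (c ∸ i) (height₁ a b c)
           (sym (trans (cong (a +_) (trans (+-assoc b i (c ∸ i)) (cong (b +_) (m+[n∸m]≡n (<⇒≤ i<c))))) total))) ⟩
    dinvCond n 1 (b + i)
      ≡⟨ dinvCond-arm₁ (b + i) (<-≤-trans (+-monoʳ-< b i<c) b+c≤2K+e) ⟩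
    (K ≤ᵇ b + i) ∎
    where open ≡-Reasoning

  dinvCell₂-upper : ∀ i → i < c → dinvCell 2 (a + b + i) ≡ true
  dinvCell₂-upper i i<c = begin
    dinvCell 2 (a + b + i)
      ≡⟨ cong₂ (λ x y → x ∧ dinvCond n y (leg n p 2 (suc (a + b + i))))
           (trans (in₂ (a + b + i)) (≤⇒≤ᵇ≡true (m≤m+n (a + b) i)))
           (arm₂ n p (suc (a + b + i))
             (out₃ (a + b + i) (subst (a + b + i <_) (trans (+-assoc a b c) total) (+-monoʳ-< (a + b) i<c)))) ⟩
    dinvCond n 0 (leg n p 2 (suc (a + b + i)))
      ≡⟨ cong (dinvCond n 0) (leg-above n p 2 i (c ∸ i) (height₂ a b c)
           (sym (trans (cong (a + b +_) (m+[n∸m]≡n (<⇒≤ i<c))) (trans (+-assoc a b c) total)))) ⟩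
    dinvCond n 0 i
      ≡⟨ dinvCond-arm₀ i ⟩
    (i ≤ᵇ K)
      ≡⟨ ≤⇒≤ᵇ≡true (≤-trans (<⇒≤ i<c) (m+k≡n⇒m≤n v (trans (+-comm c v) col₃))) ⟩
    true ∎
    where open ≡-Reasoning

  dinv-columns : ∀ t → dinv n (p , t) ≡ count (λ j → j ≤ᵇ K) b + count (λ i → K ≤ᵇ b + i) c + c
  dinv-columns t = begin
    dinv n (p , t)
      ≡⟨ countWhere-cells _ n ⟩
    count (dinvCell 1) n + (count (dinvCell 2) n + count (dinvCell 3) n)
      ≡⟨ cong₂ (λ m₁ m₂ → count (dinvCell 1) m₁ + (count (dinvCell 2) m₂ + count (dinvCell 3) n))
           (sym total) (trans (sym total) (sym (+-assoc a b c))) ⟩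
    count (dinvCell 1) (a + (b + c)) + (count (dinvCell 2) (a + b + c) + count (dinvCell 3) n)
      ≡⟨ cong₂ _+_ first-column (cong₂ _+_ second-column third-column) ⟩
    count (λ j → j ≤ᵇ K) b + count (λ i → K ≤ᵇ b + i) c + (c + 0)
      ≡⟨ cong (count (λ j → j ≤ᵇ K) b + count (λ i → K ≤ᵇ b + i) c +_) (+-identityʳ c) ⟩
    count (λ j → j ≤ᵇ K) b + count (λ i → K ≤ᵇ b + i) c + c
      ∎
    where
    open ≡-Reasoning
    first-column : count (dinvCell 1) (a + (b + c)) ≡ count (λ j → j ≤ᵇ K) b + count (λ i → K ≤ᵇ b + i) c
    first-column = begin
      count (dinvCell 1) (a + (b + c))
        ≡⟨ count-+ (dinvCell 1) a (b + c) ⟩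
      count (dinvCell 1) a + count (λ i → dinvCell 1 (a + i)) (b + c)
        ≡⟨ cong₂ _+_ (count-none (dinvCell 1) a (λ k k<a → cong (_∧ dinvCondAt 1 k) (trans (in₁ k) (>⇒≤ᵇ≡false k<a))))
                     (count-+ (λ i → dinvCell 1 (a + i)) b c) ⟩
      count (λ j → dinvCell 1 (a + j)) b + count (λ i → dinvCell 1 (a + (b + i))) c
        ≡⟨ cong₂ _+_ (count-cong _ _ b dinvCell₁-lower) (count-cong _ _ c dinvCell₁-upper) ⟩
      count (λ j → j ≤ᵇ K) b + count (λ i → K ≤ᵇ b + i) c
        ∎
    second-column : count (dinvCell 2) (a + b + c) ≡ c
    second-column = trans (cong (count (dinvCell 2)) (cong (a + b +_) (sym (+-identityʳ c))))
      (count-window (dinvCell 2) (a + b) c 0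
        (λ k k<a+b → cong (_∧ dinvCondAt 2 k) (trans (in₂ k) (>⇒≤ᵇ≡false k<a+b))) dinvCell₂-upper (λ i ()))
    third-column : count (dinvCell 3) n ≡ 0
    third-column = count-none (dinvCell 3) n (λ k k<n → cong (_∧ dinvCondAt 3 k) (out₃ k k<n))


-- The rank word

filterᵇ-reject : ∀ {A : Set} (P : A → Bool) x xs → P x ≡ false → filterᵇ P (x ∷ xs) ≡ filterᵇ P xs
filterᵇ-reject P x xs Px rewrite Px = refl

filterᵇ-accept : ∀ {A : Set} (P : A → Bool) x xs → P x ≡ true → filterᵇ P (x ∷ xs) ≡ x ∷ filterᵇ P xs
filterᵇ-accept P x xs Px rewrite Px = refl

filterᵇ-applyUpTo-none : ∀ {A : Set} (P : A → Bool) (f : ℕ → A) m →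
  (∀ k → k < m → P (f k) ≡ false) → filterᵇ P (applyUpTo f m) ≡ []
filterᵇ-applyUpTo-none P f zero    _    = refl
filterᵇ-applyUpTo-none P f (suc m) none = trans (filterᵇ-reject P (f 0) _ (none 0 z<s))
  (filterᵇ-applyUpTo-none P (f ∘ suc) m (λ k k<m → none (suc k) (s<s k<m)))

filterᵇ-applyUpTo-single : ∀ {A : Set} (P : A → Bool) (f : ℕ → A) m j → j < m →
  (∀ k → k < m → P (f k) ≡ (k ≡ᵇ j)) → filterᵇ P (applyUpTo f m) ≡ f j ∷ []
filterᵇ-applyUpTo-single P f (suc m) zero    _         only = trans (filterᵇ-accept P (f 0) _ (only 0 z<s))
  (cong (f 0 ∷_) (filterᵇ-applyUpTo-none P (f ∘ suc) m (λ k k<m → only (suc k) (s<s k<m))))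
filterᵇ-applyUpTo-single P f (suc m) (suc j) (s≤s j<m) only = trans (filterᵇ-reject P (f 0) _ (only 0 z<s))
  (filterᵇ-applyUpTo-single P (f ∘ suc) m j j<m (λ k k<m → only (suc k) (s<s k<m)))

3*-≢-3*+suc : ∀ k q δ → δ < 2 → 3 * k ≢ 3 * q + suc δ
3*-≢-3*+suc zero    q       δ _   eq = 0≢1+n (trans eq (+-suc (3 * q) δ))
3*-≢-3*+suc (suc k) zero    δ δ<2 eq = <⇒≱ δ<2 (≤-pred (≤-trans (*-monoʳ-≤ 3 (s≤s (z≤n {k}))) (≤-reflexive eq)))
3*-≢-3*+suc (suc k) (suc q) δ δ<2 eq = 3*-≢-3*+suc k q δ δ<2 (+-cancelˡ-≡ 3 _ _ (begin
  3 + 3 * k               ≡⟨ *-suc 3 k ⟨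
  3 * suc k               ≡⟨ eq ⟩
  3 * suc q + suc δ       ≡⟨ cong (_+ suc δ) (*-suc 3 q) ⟩
  3 + 3 * q + suc δ       ≡⟨ +-assoc 3 (3 * q) (suc δ) ⟩
  3 + (3 * q + suc δ)     ∎))
  where open ≡-Reasoning

when : {A : Set} → Bool → A → List A
when b x = if b then x ∷ [] else []

map-when : ∀ {A B : Set} (f : A → B) b x → map f (when b x) ≡ when b (f x)
map-when f false x = refl
map-when f true  x = refl

-- rankWord selects the cells of rank r by an anonymous predicate; it enters here as C,
-- together with its defining equation C-def (which holds by refl).
module RankedCells (n : ℕ) (C : ℕ → ℕ × ℕ → Bool)
  (C-def : ∀ r x k → C r (x , suc k) ≡ ((x * n <ᵇ 3 * k) ∧ (3 * k ≡ᵇ x * n + r))) where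

  rank-miss : ∀ r x k → 3 * k ≢ x * n + r → C r (x , suc k) ≡ false
  rank-miss r x k ≢ = trans (C-def r x k) (trans (cong ((x * n <ᵇ 3 * k) ∧_) (≢⇒≡ᵇ≡false ≢)) (∧-zeroʳ _))

  column-none : ∀ r x → (∀ k → k < n → 3 * k ≢ x * n + r) → filterᵇ (C r) (column n x) ≡ []
  column-none r x none = trans (cong (filterᵇ (C r)) (map-upTo _ n))
    (filterᵇ-applyUpTo-none (C r) (λ k → (x , suc k)) n (λ k k<n → rank-miss r x k (none k k<n)))

  column-hit : ∀ r x m → x * n + suc r ≡ 3 * m → filterᵇ (C (suc r)) (column n x) ≡ when (m <ᵇ n) (x , suc m)
  column-hit r x m eq with m <ᵇ n in m<?n
  ... | false = column-none (suc r) x (λ k k<n e → <⇒≢ (*-monoʳ-< 3 (<-≤-trans k<n n≤m)) (trans e eq))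
    where
    n≤m : n ≤ m
    n≤m = ≮⇒≥ (λ m<n → subst T m<?n (<⇒<ᵇ m<n))
  ... | true  = trans (cong (filterᵇ (C (suc r))) (map-upTo _ n))
    (filterᵇ-applyUpTo-single (C (suc r)) (λ k → (x , suc k)) n m (<ᵇ⇒< m n (subst T (sym m<?n) _)) only)
    where
    only : ∀ k → k < n → C (suc r) (x , suc k) ≡ (k ≡ᵇ m)
    only k _ with k ≟ m
    ... | yes refl = trans (C-def (suc r) x k)
          (trans (cong₂ _∧_ (<⇒<ᵇ≡true (subst (x * n <_) eq (m<m+n (x * n) z<s))) (≡⇒≡ᵇ≡true (sym eq)))
                 (sym (≡⇒≡ᵇ≡true {k} refl)))
    ... | no k≢m   = trans (rank-miss (suc r) x k (λ e → k≢m (*-cancelˡ-≡ k m 3 (trans e eq)))) (sym (≢⇒≡ᵇ≡false k≢m))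

  column₃-empty : ∀ r → filterᵇ (C r) (column n 3) ≡ []
  column₃-empty r = column-none r 3 (λ k k<n e → <⇒≢ (<-≤-trans (*-monoʳ-< 3 k<n) (m≤m+n (3 * n) r)) e)

  cells-by-column : ∀ r → filterᵇ (C r) (cells n) ≡ filterᵇ (C r) (column n 1) ++ filterᵇ (C r) (column n 2)
  cells-by-column r = begin
    filterᵇ (C r) (column n 1 ++ column n 2 ++ column n 3 ++ [])
      ≡⟨ filter-++ _ (column n 1) _ ⟩
    filterᵇ (C r) (column n 1) ++ filterᵇ (C r) (column n 2 ++ column n 3 ++ [])
      ≡⟨ cong (filterᵇ (C r) (column n 1) ++_) (filter-++ _ (column n 2) _) ⟩
    filterᵇ (C r) (column n 1) ++ filterᵇ (C r) (column n 2) ++ filterᵇ (C r) (column n 3 ++ [])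
      ≡⟨ cong (λ w → filterᵇ (C r) (column n 1) ++ filterᵇ (C r) (column n 2) ++ w)
           (trans (cong (filterᵇ (C r)) (++-identityʳ (column n 3))) (column₃-empty r)) ⟩
    filterᵇ (C r) (column n 1) ++ filterᵇ (C r) (column n 2) ++ []
      ≡⟨ cong (filterᵇ (C r) (column n 1) ++_) (++-identityʳ _) ⟩
    filterᵇ (C r) (column n 1) ++ filterᵇ (C r) (column n 2)
      ∎
    where open ≡-Reasoning

-- In each block of three consecutive ranks, the cell of column 2 comes first iff n ≡ 1 (mod 3).
inRankOrder : ℕ → List Bool → List Bool → List Bool
inRankOrder zero    col₁ col₂ = col₂ ++ col₁
inRankOrder (suc _) col₁ col₂ = col₁ ++ col₂

rankShape : ℕ → ℕ → ℕ → ℕ → List Bool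
rankShape e u v K = concatUpTo (λ j → inRankOrder e ((u ≤ᵇ j) ∷ []) ((v ≤ᵇ j) ∷ [])) K
                 ++ concatUpTo (λ i → (u ≤ᵇ K + i) ∷ []) (K + e)

module RankEntries {K e a b c u v : ℕ} (cols : Columns K e a b c u v)
  (ι : ℕ × ℕ → Bool) (ι-def : ∀ x y → ι (x , y) ≡ inLam (colPath a b c) x y)
  (C : ℕ → ℕ × ℕ → Bool)
  (C-def : ∀ r x k → C r (x , suc k) ≡ ((x * (3 * K + 1 + e) <ᵇ 3 * k) ∧ (3 * k ≡ᵇ x * (3 * K + 1 + e) + r))) where

  open Columns cols

  private
    n : ℕ
    n = 3 * K + 1 + e

  open RankedCells n C C-def

  ranked : ℕ → List Bool
  ranked r = map ι (filterᵇ (C r) (cells n))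

  block : ℕ → List Bool
  block j = ranked (suc (3 * j)) ++ ranked (suc (1 + 3 * j)) ++ ranked (suc (2 + 3 * j))

  ranked-by-column : ∀ r {X Y} →
    map ι (filterᵇ (C r) (column n 1)) ≡ X → map ι (filterᵇ (C r) (column n 2)) ≡ Y → ranked r ≡ X ++ Y
  ranked-by-column r eq₁ eq₂ =
    trans (cong (map ι) (cells-by-column r)) (trans (map-++ ι (filterᵇ (C r) (column n 1)) _) (cong₂ _++_ eq₁ eq₂))

  entry₁ : ∀ j r → 1 * n + suc r ≡ 3 * (suc K + j) →
    map ι (filterᵇ (C (suc r)) (column n 1)) ≡ when (j <ᵇ 2 * K + e) (u ≤ᵇ j)
  entry₁ j r eq = begin
    map ι (filterᵇ (C (suc r)) (column n 1))
      ≡⟨ cong (map ι) (column-hit r 1 (suc K + j) eq) ⟩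
    map ι (when (suc K + j <ᵇ n) (1 , suc (suc K + j)))
      ≡⟨ map-when ι _ _ ⟩
    when (suc K + j <ᵇ n) (ι (1 , suc (suc K + j)))
      ≡⟨ cong₂ when (trans (cong (suc K + j <ᵇ_) (split K e)) (+-<ᵇ-cancelˡ (suc K) j (2 * K + e)))
                    (trans (ι-def 1 _) (trans (inLam-row (colPath a b c) 1 _ (trans (height₁ a b c) col₁))
                                              (+-≤ᵇ-cancelˡ (suc K) u j))) ⟩
    when (j <ᵇ 2 * K + e) (u ≤ᵇ j)
      ∎
    where
    open ≡-Reasoning
    split : ∀ K e → 3 * K + 1 + e ≡ suc K + (2 * K + e)
    split = solve-∀

  entry₂ : ∀ j r → 2 * n + suc r ≡ 3 * (suc (2 * K + e) + j) →
    map ι (filterᵇ (C (suc r)) (column n 2)) ≡ when (j <ᵇ K) (v ≤ᵇ j)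
  entry₂ j r eq = begin
    map ι (filterᵇ (C (suc r)) (column n 2))
      ≡⟨ cong (map ι) (column-hit r 2 (suc (2 * K + e) + j) eq) ⟩
    map ι (when (suc (2 * K + e) + j <ᵇ n) (2 , suc (suc (2 * K + e) + j)))
      ≡⟨ map-when ι _ _ ⟩
    when (suc (2 * K + e) + j <ᵇ n) (ι (2 , suc (suc (2 * K + e) + j)))
      ≡⟨ cong₂ when (trans (cong (suc (2 * K + e) + j <ᵇ_) (split K e)) (+-<ᵇ-cancelˡ (suc (2 * K + e)) j K))
                    (trans (ι-def 2 _) (trans (inLam-row (colPath a b c) 2 _ (trans (height₂ a b c) col₂))
                                              (+-≤ᵇ-cancelˡ (suc (2 * K + e)) v j))) ⟩
    when (j <ᵇ K) (v ≤ᵇ j)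
      ∎
    where
    open ≡-Reasoning
    split : ∀ K e → 3 * K + 1 + e ≡ suc (2 * K + e) + K
    split = solve-∀

  no-entry : ∀ x r q δ → δ < 2 → x * n + r ≡ 3 * q + suc δ → map ι (filterᵇ (C r) (column n x)) ≡ []
  no-entry x r q δ δ<2 eq = cong (map ι) (column-none r x (λ k _ e → 3*-≢-3*+suc k q δ δ<2 (trans e eq)))

-- In block j, column 1 has a cell of rank 3j+2−e (in row K+j+2) and column 2 one of rank 3j+1+e
-- (in row 2K+e+j+2); for the other four pairs of column and rank, x n + r is not a multiple of 3.
module _ {K : ℕ} {a b c u v : ℕ} (ι : ℕ × ℕ → Bool) (ι-def : ∀ x y → ι (x , y) ≡ inLam (colPath a b c) x y)
         (C : ℕ → ℕ × ℕ → Bool) where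

  block-shape : ∀ {e} → e ≤ 1 → (cols : Columns K e a b c u v) →
    (C-def : ∀ r x k → C r (x , suc k) ≡ ((x * (3 * K + 1 + e) <ᵇ 3 * k) ∧ (3 * k ≡ᵇ x * (3 * K + 1 + e) + r))) →
    ∀ j → RankEntries.block cols ι ι-def C C-def j
        ≡ inRankOrder e (when (j <ᵇ 2 * K + e) (u ≤ᵇ j)) (when (j <ᵇ K) (v ≤ᵇ j))
  block-shape z≤n cols C-def j = begin
    ranked (suc (3 * j)) ++ ranked (suc (1 + 3 * j)) ++ ranked (suc (2 + 3 * j))
      ≡⟨ cong₂ _++_
           (ranked-by-column _ (no-entry 1 _ (K + j) 1 (s<s z<s) (eq₁ K j)) (entry₂ j _ (eq₂ K j)))
           (cong₂ _++_
             (ranked-by-column _ (entry₁ j _ (eq₃ K j)) (no-entry 2 _ (suc (2 * K + 0) + j) 0 z<s (eq₄ K j)))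
             (ranked-by-column _ (no-entry 1 _ (suc K + j) 0 z<s (eq₅ K j))
                                 (no-entry 2 _ (suc (2 * K + 0) + j) 1 (s<s z<s) (eq₆ K j)))) ⟩
    ([] ++ W₂) ++ (W₁ ++ []) ++ ([] ++ [])
      ≡⟨ cong (W₂ ++_) (trans (++-identityʳ _) (++-identityʳ W₁)) ⟩
    W₂ ++ W₁ ∎
    where
    open ≡-Reasoning
    open RankEntries cols ι ι-def C C-def
    W₁ = when (j <ᵇ 2 * K + 0) (u ≤ᵇ j)
    W₂ = when (j <ᵇ K) (v ≤ᵇ j)
    eq₁ : ∀ K j → 1 * (3 * K + 1 + 0) + suc (3 * j) ≡ 3 * (K + j) + suc 1
    eq₁ = solve-∀
    eq₂ : ∀ K j → 2 * (3 * K + 1 + 0) + suc (3 * j) ≡ 3 * (suc (2 * K + 0) + j)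
    eq₂ = solve-∀
    eq₃ : ∀ K j → 1 * (3 * K + 1 + 0) + suc (1 + 3 * j) ≡ 3 * (suc K + j)
    eq₃ = solve-∀
    eq₄ : ∀ K j → 2 * (3 * K + 1 + 0) + suc (1 + 3 * j) ≡ 3 * (suc (2 * K + 0) + j) + suc 0
    eq₄ = solve-∀
    eq₅ : ∀ K j → 1 * (3 * K + 1 + 0) + suc (2 + 3 * j) ≡ 3 * (suc K + j) + suc 0
    eq₅ = solve-∀
    eq₆ : ∀ K j → 2 * (3 * K + 1 + 0) + suc (2 + 3 * j) ≡ 3 * (suc (2 * K + 0) + j) + suc 1
    eq₆ = solve-∀
  block-shape (s≤s z≤n) cols C-def j = begin
    ranked (suc (3 * j)) ++ ranked (suc (1 + 3 * j)) ++ ranked (suc (2 + 3 * j))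
      ≡⟨ cong₂ _++_
           (ranked-by-column _ (entry₁ j _ (eq₁ K j)) (no-entry 2 _ (suc (2 * K) + j) 1 (s<s z<s) (eq₂ K j)))
           (cong₂ _++_
             (ranked-by-column _ (no-entry 1 _ (suc K + j) 0 z<s (eq₃ K j)) (entry₂ j _ (eq₄ K j)))
             (ranked-by-column _ (no-entry 1 _ (suc K + j) 1 (s<s z<s) (eq₅ K j))
                                 (no-entry 2 _ (suc (2 * K + 1) + j) 0 z<s (eq₆ K j)))) ⟩
    (W₁ ++ []) ++ ([] ++ W₂) ++ ([] ++ [])
      ≡⟨ cong₂ _++_ (++-identityʳ W₁) (++-identityʳ W₂) ⟩
    W₁ ++ W₂ ∎
    where
    open ≡-Reasoning
    open RankEntries cols ι ι-def C C-def
    W₁ = when (j <ᵇ 2 * K + 1) (u ≤ᵇ j)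
    W₂ = when (j <ᵇ K) (v ≤ᵇ j)
    eq₁ : ∀ K j → 1 * (3 * K + 1 + 1) + suc (3 * j) ≡ 3 * (suc K + j)
    eq₁ = solve-∀
    eq₂ : ∀ K j → 2 * (3 * K + 1 + 1) + suc (3 * j) ≡ 3 * (suc (2 * K) + j) + suc 1
    eq₂ = solve-∀
    eq₃ : ∀ K j → 1 * (3 * K + 1 + 1) + suc (1 + 3 * j) ≡ 3 * (suc K + j) + suc 0
    eq₃ = solve-∀
    eq₄ : ∀ K j → 2 * (3 * K + 1 + 1) + suc (1 + 3 * j) ≡ 3 * (suc (2 * K + 1) + j)
    eq₄ = solve-∀
    eq₅ : ∀ K j → 1 * (3 * K + 1 + 1) + suc (2 + 3 * j) ≡ 3 * (suc K + j) + suc 1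
    eq₅ = solve-∀
    eq₆ : ∀ K j → 2 * (3 * K + 1 + 1) + suc (2 + 3 * j) ≡ 3 * (suc (2 * K + 1) + j) + suc 0
    eq₆ = solve-∀

inRankOrder-[]ʳ : ∀ e xs → inRankOrder e xs [] ≡ xs
inRankOrder-[]ʳ zero    xs = refl
inRankOrder-[]ʳ (suc e) xs = ++-identityʳ xs

inRankOrder-[] : ∀ e → inRankOrder e [] [] ≡ []
inRankOrder-[] zero    = refl
inRankOrder-[] (suc e) = refl

rep-[] : ∀ {A : Set} m → rep {A} m [] ≡ []
rep-[] zero    = refl
rep-[] (suc m) = rep-[] m

blocks-shape : ∀ K e (x y : ℕ → Bool) →
  concatUpTo (λ j → inRankOrder e (when (j <ᵇ 2 * K + e) (x j)) (when (j <ᵇ K) (y j))) (3 * K + 1 + e)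
  ≡ concatUpTo (λ j → inRankOrder e (x j ∷ []) (y j ∷ [])) K ++ concatUpTo (λ i → x (K + i) ∷ []) (K + e)
blocks-shape K e x y = begin
  concatUpTo B (3 * K + 1 + e)
    ≡⟨ cong (concatUpTo B) (split K e) ⟩
  concatUpTo B (K + ((K + e) + suc K))
    ≡⟨ concatUpTo-+ B K _ ⟩
  concatUpTo B K ++ concatUpTo (λ i → B (K + i)) ((K + e) + suc K)
    ≡⟨ cong (concatUpTo B K ++_) (concatUpTo-+ (λ i → B (K + i)) (K + e) (suc K)) ⟩
  concatUpTo B K ++ concatUpTo (λ i → B (K + i)) (K + e) ++ concatUpTo (λ i → B (K + (K + e + i))) (suc K)
    ≡⟨ cong₂ _++_ (concatUpTo-cong _ _ K pairs) (cong₂ _++_ (concatUpTo-cong _ _ (K + e) singles)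
         (trans (concatUpTo-cong _ _ (suc K) empties) (rep-[] (suc K)))) ⟩
  concatUpTo (λ j → inRankOrder e (x j ∷ []) (y j ∷ [])) K ++ concatUpTo (λ i → x (K + i) ∷ []) (K + e) ++ []
    ≡⟨ cong (concatUpTo (λ j → inRankOrder e (x j ∷ []) (y j ∷ [])) K ++_) (++-identityʳ _) ⟩
  concatUpTo (λ j → inRankOrder e (x j ∷ []) (y j ∷ [])) K ++ concatUpTo (λ i → x (K + i) ∷ []) (K + e)
    ∎
  where
  open ≡-Reasoning
  B : ℕ → List Bool
  B j = inRankOrder e (when (j <ᵇ 2 * K + e) (x j)) (when (j <ᵇ K) (y j))
  split : ∀ K e → 3 * K + 1 + e ≡ K + ((K + e) + suc K)
  split = solve-∀
  2K+e≡ : 2 * K + e ≡ K + (K + e)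
  2K+e≡ = trans (cong (_+ e) (cong (K +_) (+-identityʳ K))) (+-assoc K K e)
  pairs : ∀ j → j < K → B j ≡ inRankOrder e (x j ∷ []) (y j ∷ [])
  pairs j j<K = cong₂ (λ p q → inRankOrder e (when p (x j)) (when q (y j)))
    (<⇒<ᵇ≡true (<-≤-trans j<K (subst (K ≤_) (sym 2K+e≡) (m≤m+n K (K + e))))) (<⇒<ᵇ≡true j<K)
  singles : ∀ i → i < K + e → B (K + i) ≡ x (K + i) ∷ []
  singles i i<K+e = trans (cong₂ (λ p q → inRankOrder e (when p (x (K + i))) (when q (y (K + i))))
    (<⇒<ᵇ≡true (subst (K + i <_) (sym 2K+e≡) (+-monoʳ-< K i<K+e))) (≥⇒<ᵇ≡false (m≤m+n K i)))
    (inRankOrder-[]ʳ e _)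
  empties : ∀ i → i < suc K → B (K + (K + e + i)) ≡ []
  empties i _ = trans (cong₂ (λ p q → inRankOrder e (when p (x (K + (K + e + i)))) (when q (y (K + (K + e + i)))))
    (≥⇒<ᵇ≡false (subst (_≤ K + (K + e + i)) (sym 2K+e≡) (+-monoʳ-≤ K (m≤m+n (K + e) i))))
    (≥⇒<ᵇ≡false (m≤m+n K (K + e + i))))
    (inRankOrder-[] e)

rankWord-columns : ∀ {K e} → e ≤ 1 → ∀ {a b c u v} → Columns K e a b c u v → ∀ t →
  rankWord (3 * K + 1 + e) (colPath a b c , t) ≡ rankShape e u v K
rankWord-columns {K} {e} e≤1 {a} {b} {c} {u} {v} cols t = shape _ (λ _ _ → refl) _ (λ _ _ _ → refl)
  where
  shape : ∀ ι ι-def C C-def →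
    concatMap (RankEntries.ranked cols ι ι-def C C-def) (map suc (upTo (3 * (3 * K + 1 + e)))) ≡ rankShape e u v K
  shape ι ι-def C C-def = begin
    concatMap ranked (map suc (upTo (3 * (3 * K + 1 + e))))
      ≡⟨ concatMap-upTo-suc ranked (3 * (3 * K + 1 + e)) ⟩
    concatUpTo (ranked ∘ suc) (3 * (3 * K + 1 + e))
      ≡⟨ concatUpTo-triples (ranked ∘ suc) (3 * K + 1 + e) ⟩
    concatUpTo block (3 * K + 1 + e)
      ≡⟨ concatUpTo-cong _ _ (3 * K + 1 + e) (λ j _ → block-shape ι ι-def C e≤1 cols C-def j) ⟩
    concatUpTo (λ j → inRankOrder e (when (j <ᵇ 2 * K + e) (u ≤ᵇ j)) (when (j <ᵇ K) (v ≤ᵇ j))) (3 * K + 1 + e)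
      ≡⟨ blocks-shape K e (u ≤ᵇ_) (v ≤ᵇ_) ⟩
    rankShape e u v K
      ∎
    where
    open ≡-Reasoning
    open RankEntries cols ι ι-def C C-def

FF TF FT TT : List Bool
FF = false ∷ false ∷ []
TF = true ∷ false ∷ []
FT = false ∷ true ∷ []
TT = true ∷ true ∷ []

pair≡ : ∀ {x y x′ y′ : Bool} → x ≡ x′ → y ≡ y′ → x ∷ y ∷ [] ≡ x′ ∷ y′ ∷ []
pair≡ = cong₂ (λ x y → x ∷ y ∷ [])

single≡ : ∀ {x x′ : Bool} → x ≡ x′ → x ∷ [] ≡ x′ ∷ []
single≡ = cong (_∷ [])

thresholdPairs : ℕ → ℕ → ℕ → List Bool
thresholdPairs s t m = concatUpTo (λ j → (s ≤ᵇ j) ∷ (t ≤ᵇ j) ∷ []) m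

thresholdSingles : ℕ → ℕ → ℕ → List Bool
thresholdSingles s K m = concatUpTo (λ i → (s ≤ᵇ K + i) ∷ []) m

thresholdPairs-cong : ∀ s t m {s′ t′ m′} → s ≡ s′ → t ≡ t′ → m ≡ m′ →
  thresholdPairs s t m ≡ thresholdPairs s′ t′ m′
thresholdPairs-cong s t m refl refl refl = refl

pairs-TF : ∀ s d q → thresholdPairs s (s + d) (s + (d + q))
  ≡ rep s FF ++ rep d TF ++ rep q TT
pairs-TF s d q = concatUpTo-runs _ s d q _ _ _
  (λ i i<s → pair≡ (>⇒≤ᵇ≡false i<s) (>⇒≤ᵇ≡false (<-≤-trans i<s (m≤m+n s d))))
  (λ i i<d → pair≡ (≤⇒≤ᵇ≡true (m≤m+n s i)) (>⇒≤ᵇ≡false (+-monoʳ-< s i<d)))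
  (λ i _ → pair≡ (≤⇒≤ᵇ≡true (m≤m+n s (d + i))) (≤⇒≤ᵇ≡true (+-monoʳ-≤ s (m≤m+n d i))))

pairs-FT : ∀ s d q → thresholdPairs (s + d) s (s + (d + q))
  ≡ rep s FF ++ rep d FT ++ rep q TT
pairs-FT s d q = concatUpTo-runs _ s d q _ _ _
  (λ i i<s → pair≡ (>⇒≤ᵇ≡false (<-≤-trans i<s (m≤m+n s d))) (>⇒≤ᵇ≡false i<s))
  (λ i i<d → pair≡ (>⇒≤ᵇ≡false (+-monoʳ-< s i<d)) (≤⇒≤ᵇ≡true (m≤m+n s i)))
  (λ i _ → pair≡ (≤⇒≤ᵇ≡true (+-monoʳ-≤ s (m≤m+n d i))) (≤⇒≤ᵇ≡true (m≤m+n s (d + i))))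

pairs-TF-cut : ∀ s d t → s + d ≤ t → thresholdPairs s t (s + d) ≡ rep s FF ++ rep d TF
pairs-TF-cut s d t s+d≤t = concatUpTo-runs₂ _ s d _ _
  (λ i i<s → pair≡ (>⇒≤ᵇ≡false i<s) (>⇒≤ᵇ≡false (<-≤-trans i<s (≤-trans (m≤m+n s d) s+d≤t))))
  (λ i i<d → pair≡ (≤⇒≤ᵇ≡true (m≤m+n s i)) (>⇒≤ᵇ≡false (<-≤-trans (+-monoʳ-< s i<d) s+d≤t)))

pairs-FT-cut : ∀ s d t → s + d ≤ t → thresholdPairs t s (s + d) ≡ rep s FF ++ rep d FT
pairs-FT-cut s d t s+d≤t = concatUpTo-runs₂ _ s d _ _
  (λ i i<s → pair≡ (>⇒≤ᵇ≡false (<-≤-trans i<s (≤-trans (m≤m+n s d) s+d≤t))) (>⇒≤ᵇ≡false i<s))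
  (λ i i<d → pair≡ (>⇒≤ᵇ≡false (<-≤-trans (+-monoʳ-< s i<d) s+d≤t)) (≤⇒≤ᵇ≡true (m≤m+n s i)))

singles-true : ∀ s K m → s ≤ K → thresholdSingles s K m ≡ rep m (true ∷ [])
singles-true s K m s≤K = concatUpTo-cong _ _ m (λ i _ → single≡ (≤⇒≤ᵇ≡true (≤-trans s≤K (m≤m+n K i))))

singles-cut : ∀ K c r → thresholdSingles (K + c) K (c + r) ≡ rep c (false ∷ []) ++ rep r (true ∷ [])
singles-cut K c r = concatUpTo-runs₂ _ c r _ _
  (λ i i<c → single≡ (trans (+-≤ᵇ-cancelˡ K c i) (>⇒≤ᵇ≡false i<c)))
  (λ i _ → single≡ (trans (+-≤ᵇ-cancelˡ K c (c + i)) (≤⇒≤ᵇ≡true (m≤m+n c i))))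


-- Counting skips

++-assoc₃ : ∀ {A : Set} (xs ys zs ws : List A) → (xs ++ ys ++ zs) ++ ws ≡ xs ++ ys ++ zs ++ ws
++-assoc₃ xs ys zs ws = trans (++-assoc xs _ ws) (cong (xs ++_) (++-assoc ys zs ws))

skips-unseen : ∀ g w → skipsAux false g w ≡ skipsAux false false w
skips-unseen g []          = refl
skips-unseen g (true ∷ w)  = refl
skips-unseen g (false ∷ w) = refl

skips-unseen-FF : ∀ g m w → skipsAux false g (rep m FF ++ w) ≡ skipsAux false false w
skips-unseen-FF g zero    w = skips-unseen g w
skips-unseen-FF g (suc m) w = skips-unseen-FF true m w

skips-unseen-F : ∀ g m w → skipsAux false g (rep m (false ∷ []) ++ w) ≡ skipsAux false false w
skips-unseen-F g zero    w = skips-unseen g w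
skips-unseen-F g (suc m) w = skips-unseen-F true m w

skips-gap-F : ∀ m w → skipsAux true true (rep m (false ∷ []) ++ w) ≡ skipsAux true true w
skips-gap-F zero    w = refl
skips-gap-F (suc m) w = skips-gap-F m w

skips-TF : ∀ m w → skipsAux true true (rep m TF ++ w) ≡ m + skipsAux true true w
skips-TF zero    w = refl
skips-TF (suc m) w = cong suc (skips-TF m w)

skips-FT : ∀ m w → skipsAux true false (rep m FT ++ w) ≡ m + skipsAux true false w
skips-FT zero    w = refl
skips-FT (suc m) w = cong suc (skips-FT m w)

skips-trues : ∀ q r → skipsAux true false (rep q TT ++ rep r (true ∷ [])) ≡ 0
skips-trues (suc q) r       = skips-trues q r
skips-trues zero    (suc r) = skips-trues zero r
skips-trues zero    zero    = refl

skips-gap-trues : ∀ q r → skipsAux true true (rep q TT ++ rep (suc r) (true ∷ [])) ≡ 1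
skips-gap-trues zero    r = cong suc (skips-trues zero r)
skips-gap-trues (suc q) r = cong suc (skips-trues q (suc r))

skips-unseen-trues : ∀ g q r → skipsAux false g (rep q TT ++ rep r (true ∷ [])) ≡ 0
skips-unseen-trues g q r = trans (skips-unseen g (rep q TT ++ rep r (true ∷ []))) (from-start q r)
  where
  from-start : ∀ q r → skipsAux false false (rep q TT ++ rep r (true ∷ [])) ≡ 0
  from-start (suc q) r       = skips-trues q r
  from-start zero    (suc r) = skips-trues zero r
  from-start zero    zero    = refl

skips-TF-pairs : ∀ p x q r → 0 < r →
  skipsAux false false ((rep p FF ++ rep x TF ++ rep q TT)
                        ++ rep r (true ∷ [])) ≡ x
skips-TF-pairs p x q (suc r) _ =
  trans (cong (skipsAux false false) (++-assoc₃ (rep p FF) (rep x TF) (rep q TT) (rep (suc r) (true ∷ []))))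
  (trans (skips-unseen-FF false p (rep x TF ++ rest)) (go x))
  where
  rest : List Bool
  rest = rep q TT ++ rep (suc r) (true ∷ [])
  go : ∀ x → skipsAux false false (rep x TF ++ rest) ≡ x
  go zero    = skips-unseen-trues false q (suc r)
  go (suc x) = trans (skips-TF x rest) (trans (cong (x +_) (skips-gap-trues q r)) (+-comm x 1))

skips-FT-pairs : ∀ p z q r →
  skipsAux false false ((rep p FF ++ rep (suc z) FT ++ rep q TT)
                        ++ rep r (true ∷ [])) ≡ z
skips-FT-pairs p z q r =
  trans (cong (skipsAux false false) (++-assoc₃ (rep p FF) (rep (suc z) FT) (rep q TT) (rep r (true ∷ []))))
  (trans (skips-unseen-FF false p (rep (suc z) FT ++ rest))
  (trans (skips-FT z rest) (trans (cong (z +_) (skips-trues q r)) (+-identityʳ z))))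
  where
  rest : List Bool
  rest = rep q TT ++ rep r (true ∷ [])

skips-TF-cut : ∀ p L c w →
  skipsAux false false ((rep p FF ++ rep L TF)
                        ++ rep c (false ∷ []) ++ rep (L + w) (true ∷ [])) ≡ L
skips-TF-cut p L c w = trans (cong (skipsAux false false) (++-assoc (rep p FF) (rep L TF) (rest L)))
  (trans (skips-unseen-FF false p (rep L TF ++ rest L)) (go L))
  where
  rest : ℕ → List Bool
  rest L = rep c (false ∷ []) ++ rep (L + w) (true ∷ [])
  go : ∀ L → skipsAux false false (rep L TF ++ rest L) ≡ L
  go zero    = trans (skips-unseen-F false c (rep w (true ∷ []))) (skips-unseen-trues false zero w)
  go (suc l) = trans (skips-TF l (rest (suc l)))
    (trans (cong (l +_) (trans (skips-gap-F c (rep (suc l + w) (true ∷ []))) (skips-gap-trues zero (l + w)))) (+-comm l 1))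

skips-FT-cut : ∀ p L c w →
  skipsAux false false ((rep p FF ++ rep L FT)
                        ++ rep (suc c) (false ∷ []) ++ rep (L + w) (true ∷ [])) ≡ L
skips-FT-cut p L c w = trans (cong (skipsAux false false) (++-assoc (rep p FF) (rep L FT) (rest L)))
  (trans (skips-unseen-FF false p (rep L FT ++ rest L)) (go L))
  where
  rest : ℕ → List Bool
  rest L = rep (suc c) (false ∷ []) ++ rep (L + w) (true ∷ [])
  go : ∀ L → skipsAux false false (rep L FT ++ rest L) ≡ L
  go zero    = trans (skips-unseen-F false (suc c) (rep w (true ∷ []))) (skips-unseen-trues false zero w)
  go (suc l) = trans (skips-FT l (rest (suc l)))
    (trans (cong (l +_) (trans (skips-gap-F c (rep (suc l + w) (true ∷ []))) (skips-gap-trues zero (l + w)))) (+-comm l 1))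


open ColumnStatistics using (area-columns; dinv-columns)

-- In the coordinates u, v of Columns: region A is K + e ≤ u, region B is v + e ≤ u < K + e,
-- and region C is u < v + e.
data Region (K e : ℕ) : List Step → Set where
  regionA : ∀ c w L → K ≡ c + w + L →
    Region K e (colPath (suc K + (K + e + c)) w L)
  regionB : ∀ v x y → K ≡ v + x + suc y →
    Region K e (colPath (suc K + (v + x + e)) (v + suc y) (x + suc y))
  regionC : ∀ u v z L → u + suc z ≡ v + e → K ≡ v + L →
    Region K e (colPath (suc K + u) (suc K + z) L)

module _ {K e : ℕ} where

  regionArea regionDinv regionSkip : ∀ {p} → Region K e p → ℕ
  regionArea (regionA c w L _)     = (K + e + c) + (c + w)
  regionArea (regionB v x y _)     = (v + x + e) + v
  regionArea (regionC u v z L _ _) = u + v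
  regionDinv (regionA c w L _)     = w + L
  regionDinv (regionB v x y _)     = suc K + suc (2 * y)
  regionDinv (regionC u v z L _ _) = suc K + 2 * L
  regionSkip (regionA c w L _)     = L
  regionSkip (regionB v x y _)     = x
  regionSkip (regionC u v z L _ _) = z

record Statistics (n : ℕ) (p : List Step) (α δ σ : ℕ) : Set where
  field
    area≡ : ∀ t → area n (p , t) ≡ α
    dinv≡ : ∀ t → dinv n (p , t) ≡ δ
    skip≡ : ∀ t → skip n (p , t) ≡ σ

statistics-columns : ∀ {K e} → e ≤ 1 → ∀ {a b c u v} → Columns K e a b c u v → ∀ {δ σ} →
  count (λ j → j ≤ᵇ K) b + count (λ i → K ≤ᵇ b + i) c + c ≡ δ →
  skipsAux false false (rankShape e u v K) ≡ σ →
  Statistics (3 * K + 1 + e) (colPath a b c) (u + v) δ σ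
statistics-columns e≤1 cols δ≡ σ≡ = record
  { area≡ = area-columns e≤1 cols
  ; dinv≡ = λ t → trans (dinv-columns e≤1 cols t) δ≡
  ; skip≡ = λ t → trans (cong (skipsAux false false) (rankWord-columns e≤1 cols t)) σ≡
  }

columns-A : ∀ {e} c w L → let K = c + w + L in
  Columns K e (suc K + (K + e + c)) w L (K + e + c) (c + w)
columns-A {e} c w L = record { col₁ = refl ; col₂ = eq c w L e ; col₃ = refl }
  where
  eq : ∀ c w L e → suc (c + w + L) + (c + w + L + e + c) + w ≡ suc (2 * (c + w + L) + e) + (c + w)
  eq = solve-∀

columns-B : ∀ {e} v x y → let K = v + x + suc y in
  Columns K e (suc K + (v + x + e)) (v + suc y) (x + suc y) (v + x + e) v
columns-B {e} v x y = record { col₁ = refl ; col₂ = eq₂ v x y e ; col₃ = eq₃ v x y }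
  where
  eq₂ : ∀ v x y e → suc (v + x + suc y) + (v + x + e) + (v + suc y) ≡ suc (2 * (v + x + suc y) + e) + v
  eq₂ = solve-∀
  eq₃ : ∀ v x y → v + (x + suc y) ≡ v + x + suc y
  eq₃ = solve-∀

columns-C : ∀ {K e} u v z L → u + suc z ≡ v + e → v + L ≡ K →
  Columns K e (suc K + u) (suc K + z) L u v
columns-C {K} {e} u v z L u+z+1≡v+e v+L≡K = record { col₁ = refl ; col₂ = col₂ ; col₃ = v+L≡K }
  where
  col₂ : suc K + u + (suc K + z) ≡ suc (2 * K + e) + v
  col₂ = begin
    suc K + u + (suc K + z)     ≡⟨ eq₁ K u z ⟩
    suc (2 * K) + (u + suc z)   ≡⟨ cong (suc (2 * K) +_) u+z+1≡v+e ⟩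
    suc (2 * K) + (v + e)       ≡⟨ eq₂ K v e ⟩
    suc (2 * K + e) + v         ∎
    where
    open ≡-Reasoning
    eq₁ : ∀ K u z → suc K + u + (suc K + z) ≡ suc (2 * K) + (u + suc z)
    eq₁ = solve-∀
    eq₂ : ∀ K v e → suc (2 * K) + (v + e) ≡ suc (2 * K + e) + v
    eq₂ = solve-∀

statistics-A : ∀ {e} → e ≤ 1 → ∀ c w L → let K = c + w + L in
  Statistics (3 * K + 1 + e) (colPath (suc K + (K + e + c)) w L) (K + e + c + (c + w)) (w + L) L
statistics-A {e} e≤1 c w L = statistics-columns e≤1 (columns-A c w L) dinv-count (skip-word e≤1)
  where
  K = c + w + L
  dinv-count : count (λ j → j ≤ᵇ K) w + count (λ i → K ≤ᵇ w + i) L + L ≡ w + L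
  dinv-count = trans (cong₂ (λ x y → x + y + L)
    (count-all _ w (λ j j<w → ≤⇒≤ᵇ≡true (≤-trans (<⇒≤ j<w) (≤-trans (m≤n+m w c) (m≤m+n (c + w) L)))))
    (count-none _ L (λ i i<L → >⇒≤ᵇ≡false (<-≤-trans (+-monoʳ-< w i<L) (m+k≡n⇒m≤n c (eq c w L))))))
    (cong (_+ L) (+-identityʳ w))
    where
    eq : ∀ c w L → w + L + c ≡ c + w + L
    eq = solve-∀
  K≤u : K ≤ K + e + c
  K≤u = ≤-trans (m≤m+n K e) (m≤m+n (K + e) c)
  skip-word : e ≤ 1 → skipsAux false false (rankShape e (K + e + c) (c + w) K) ≡ L
  skip-word z≤n = trans (cong (skipsAux false false) (cong₂ _++_
    (pairs-TF-cut (c + w) L (K + 0 + c) K≤u)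
    (trans (cong₂ (λ s m → thresholdSingles s K m) (eq₁ K c) (eq₂ c w L)) (singles-cut K c (L + w)))))
    (skips-TF-cut (c + w) L c w)
    where
    eq₁ : ∀ K c → K + 0 + c ≡ K + c
    eq₁ = solve-∀
    eq₂ : ∀ c w L → c + w + L + 0 ≡ c + (L + w)
    eq₂ = solve-∀
  skip-word (s≤s z≤n) = trans (cong (skipsAux false false) (cong₂ _++_
    (pairs-FT-cut (c + w) L (K + 1 + c) K≤u)
    (trans (cong₂ (λ s m → thresholdSingles s K m) (eq₁ K c) (eq₂ c w L)) (singles-cut K (suc c) (L + w)))))
    (skips-FT-cut (c + w) L c w)
    where
    eq₁ : ∀ K c → K + 1 + c ≡ K + suc c
    eq₁ = solve-∀
    eq₂ : ∀ c w L → c + w + L + 1 ≡ suc c + (L + w)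
    eq₂ = solve-∀

statistics-B : ∀ {e} → e ≤ 1 → ∀ v x y → let K = v + x + suc y in
  Statistics (3 * K + 1 + e) (colPath (suc K + (v + x + e)) (v + suc y) (x + suc y)) (v + x + e + v) (suc K + suc (2 * y)) x
statistics-B {e} e≤1 v x y = statistics-columns e≤1 (columns-B v x y) dinv-count (skip-word e≤1)
  where
  K = v + x + suc y
  dinv-count : count (λ j → j ≤ᵇ K) (v + suc y) + count (λ i → K ≤ᵇ v + suc y + i) (x + suc y) + (x + suc y)
             ≡ suc K + suc (2 * y)
  dinv-count = trans (cong₂ (λ p q → p + q + (x + suc y))
    (count-all _ (v + suc y) (λ j j<b → ≤⇒≤ᵇ≡true (≤-trans (<⇒≤ j<b) (m+k≡n⇒m≤n x (eq₁ v x y)))))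
    (trans (cong (count (λ i → K ≤ᵇ v + suc y + i)) (cong (x +_) (sym (+-identityʳ (suc y)))))
      (count-window _ x (suc y) 0
        (λ i i<x → >⇒≤ᵇ≡false (subst (v + suc y + i <_) (eq₁ v x y) (+-monoʳ-< (v + suc y) i<x)))
        (λ i _ → ≤⇒≤ᵇ≡true (m+k≡n⇒m≤n i (eq₂ v x y i)))
        (λ i ()))))
    (eq₃ v x y)
    where
    eq₁ : ∀ v x y → v + suc y + x ≡ v + x + suc y
    eq₁ = solve-∀
    eq₂ : ∀ v x y i → v + x + suc y + i ≡ v + suc y + (x + i)
    eq₂ = solve-∀
    eq₃ : ∀ v x y → v + suc y + suc y + (x + suc y) ≡ suc (v + x + suc y) + suc (2 * y)
    eq₃ = solve-∀
  skip-word : e ≤ 1 → skipsAux false false (rankShape e (v + x + e) v K) ≡ x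
  skip-word z≤n = trans (cong (skipsAux false false) (cong₂ _++_
    (trans (thresholdPairs-cong v (v + x + 0) K refl (+-identityʳ (v + x)) (+-assoc v x (suc y))) (pairs-TF v x (suc y)))
    (singles-true (v + x + 0) K (K + 0) (m+k≡n⇒m≤n (suc y) (eq v x y)))))
    (skips-TF-pairs v x (suc y) (K + 0) (m+k≡n⇒m≤n (v + x + y + 0) (eq′ v x y)))
    where
    eq : ∀ v x y → v + x + 0 + suc y ≡ v + x + suc y
    eq = solve-∀
    eq′ : ∀ v x y → 1 + (v + x + y + 0) ≡ v + x + suc y + 0
    eq′ = solve-∀
  skip-word (s≤s z≤n) = trans (cong (skipsAux false false) (cong₂ _++_
    (trans (thresholdPairs-cong (v + x + 1) v K (eq₁ v x) refl (eq₂ v x y)) (pairs-FT v (suc x) y))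
    (singles-true (v + x + 1) K (K + 1) (m+k≡n⇒m≤n y (eq₃ v x y)))))
    (skips-FT-pairs v x y (K + 1))
    where
    eq₁ : ∀ v x → v + x + 1 ≡ v + suc x
    eq₁ = solve-∀
    eq₂ : ∀ v x y → v + x + suc y ≡ v + (suc x + y)
    eq₂ = solve-∀
    eq₃ : ∀ v x y → v + x + 1 + y ≡ v + x + suc y
    eq₃ = solve-∀

statistics-C : ∀ {e} → e ≤ 1 → ∀ u v z L → u + suc z ≡ v + e → let K = v + L in
  Statistics (3 * K + 1 + e) (colPath (suc K + u) (suc K + z) L) (u + v) (suc K + 2 * L) z
statistics-C {e} e≤1 u v z L u+z+1≡v+e =
  statistics-columns e≤1 (columns-C u v z L u+z+1≡v+e refl) dinv-count (skip-word e≤1 u+z+1≡v+e)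
  where
  K = v + L
  dinv-count : count (λ j → j ≤ᵇ K) (suc K + z) + count (λ i → K ≤ᵇ suc K + z + i) L + L ≡ suc K + 2 * L
  dinv-count = trans (cong₂ (λ p q → p + q + L)
    (trans (count-+ (λ j → j ≤ᵇ K) (suc K) z) (cong₂ _+_
      (count-all _ (suc K) (λ j j<K+1 → ≤⇒≤ᵇ≡true (≤-pred j<K+1)))
      (count-none _ z (λ i _ → >⇒≤ᵇ≡false (s≤s (m≤m+n K i))))))
    (count-all _ L (λ i _ → ≤⇒≤ᵇ≡true (≤-trans (n≤1+n K) (≤-trans (m≤m+n (suc K) z) (m≤m+n (suc K + z) i))))))
    (eq (suc K) L)
    where
    eq : ∀ X L → X + 0 + L + L ≡ X + 2 * L
    eq = solve-∀
  u<v+e : u < v + e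
  u<v+e = m+k≡n⇒m≤n z (trans (sym (+-suc u z)) u+z+1≡v+e)
  skip-word : e ≤ 1 → u + suc z ≡ v + e → skipsAux false false (rankShape e u v K) ≡ z
  skip-word z≤n eq = trans (cong (skipsAux false false) (cong₂ _++_
    (trans (thresholdPairs-cong v u K v≡ refl K≡) (pairs-FT u (suc z) L))
    (singles-true u K (K + 0) (≤-trans (<⇒≤ (subst (u <_) (+-identityʳ v) u<v+e)) (m≤m+n v L)))))
    (skips-FT-pairs u z L (K + 0))
    where
    v≡ : v ≡ u + suc z
    v≡ = sym (trans eq (+-identityʳ v))
    K≡ : K ≡ u + (suc z + L)
    K≡ = trans (cong (_+ L) v≡) (+-assoc u (suc z) L)
  skip-word (s≤s z≤n) eq = trans (cong (skipsAux false false) (cong₂ _++_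
    (trans (thresholdPairs-cong u v K refl v≡ K≡) (pairs-TF u z L))
    (singles-true u K (K + 1) (≤-trans (m≤m+n u z) (≤-trans (≤-reflexive (sym v≡)) (m≤m+n v L))))))
    (skips-TF-pairs u z L (K + 1) (m+k≡n⇒m≤n K (+-comm 1 K)))
    where
    v≡ : v ≡ u + z
    v≡ = sym (+-cancelʳ-≡ 1 (u + z) v (trans (+-assoc u z 1) (trans (cong (u +_) (+-comm z 1)) eq)))
    K≡ : K ≡ u + (z + L)
    K≡ = trans (cong (_+ L) v≡) (+-assoc u z L)


region-statistics : ∀ {K e} → e ≤ 1 → ∀ {p} (R : Region K e p) →
  Statistics (3 * K + 1 + e) p (regionArea R) (regionDinv R) (regionSkip R)
region-statistics e≤1 (regionA c w L refl)       = statistics-A e≤1 c w L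
region-statistics e≤1 (regionB v x y refl)       = statistics-B e≤1 v x y
region-statistics e≤1 (regionC u v z L eq refl)  = statistics-C e≤1 u v z L eq

region-isDyck : ∀ {K e} → e ≤ 1 → ∀ {p} → Region K e p → T (isDyck (3 * K + 1 + e) p)
region-isDyck e≤1 (regionA c w L refl)      = Decomposition.columns⇒dyck _ _ e≤1 (columns-A c w L)
region-isDyck e≤1 (regionB v x y refl)      = Decomposition.columns⇒dyck _ _ e≤1 (columns-B v x y)
region-isDyck e≤1 (regionC u v z L eq refl) = Decomposition.columns⇒dyck _ _ e≤1 (columns-C u v z L eq refl)

region-sum : ∀ {K e p} (R : Region K e p) → regionArea R + (regionDinv R + regionSkip R) ≡ 3 * K + e
region-sum {e = e} (regionA c w L refl) = eq c w L e
  where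
  eq : ∀ c w L e → c + w + L + e + c + (c + w) + (w + L + L) ≡ 3 * (c + w + L) + e
  eq = solve-∀
region-sum {e = e} (regionB v x y refl) = eq v x y e
  where
  eq : ∀ v x y e → v + x + e + v + (suc (v + x + suc y) + suc (2 * y) + x) ≡ 3 * (v + x + suc y) + e
  eq = solve-∀
region-sum {e = e} (regionC u v z L u+z+1≡v+e refl) = begin
  u + v + (suc (v + L) + 2 * L + z)   ≡⟨ eq₁ u v z L ⟩
  u + suc z + (2 * v + 3 * L)         ≡⟨ cong (_+ (2 * v + 3 * L)) u+z+1≡v+e ⟩
  v + e + (2 * v + 3 * L)             ≡⟨ eq₂ v L e ⟩
  3 * (v + L) + e                     ∎
  where
  open ≡-Reasoning
  eq₁ : ∀ u v z L → u + v + (suc (v + L) + 2 * L + z) ≡ u + suc z + (2 * v + 3 * L)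
  eq₁ = solve-∀
  eq₂ : ∀ v L e → v + e + (2 * v + 3 * L) ≡ 3 * (v + L) + e
  eq₂ = solve-∀

u+z≤v : ∀ {e u v z} → e ≤ 1 → u + suc z ≡ v + e → u + z ≤ v
u+z≤v {e} {u} {v} {z} e≤1 eq = ≤-pred (begin
  suc (u + z)  ≡⟨ +-suc u z ⟨
  u + suc z    ≡⟨ eq ⟩
  v + e        ≤⟨ +-monoʳ-≤ v e≤1 ⟩
  v + 1        ≡⟨ +-comm v 1 ⟩
  suc v        ∎)
  where open ≤-Reasoning

region-skip≤area : ∀ {K e p} → e ≤ 1 → (R : Region K e p) → regionSkip R ≤ regionArea R
region-skip≤area {e = e} _ (regionA c w L refl) = m+k≡n⇒m≤n (c + w + e + c + (c + w)) (eq c w L e)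
  where
  eq : ∀ c w L e → L + (c + w + e + c + (c + w)) ≡ c + w + L + e + c + (c + w)
  eq = solve-∀
region-skip≤area {e = e} _ (regionB v x y refl) = m+k≡n⇒m≤n (v + e + v) (eq v x e)
  where
  eq : ∀ v x e → x + (v + e + v) ≡ v + x + e + v
  eq = solve-∀
region-skip≤area e≤1 (regionC u v z L u+z+1≡v+e refl) =
  ≤-trans (m≤n+m z u) (≤-trans (u+z≤v e≤1 u+z+1≡v+e) (m≤n+m v u))

region-skip≤dinv : ∀ {K e p} → e ≤ 1 → (R : Region K e p) → regionSkip R ≤ regionDinv R
region-skip≤dinv _ (regionA c w L refl) = m≤n+m L w
region-skip≤dinv _ (regionB v x y refl) =
  ≤-trans (m≤n+m x v) (≤-trans (m≤m+n (v + x) (suc y)) (≤-trans (n≤1+n _) (m≤m+n _ (suc (2 * y)))))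
region-skip≤dinv e≤1 (regionC u v z L u+z+1≡v+e refl) =
  ≤-trans (m≤n+m z u) (≤-trans (u+z≤v e≤1 u+z+1≡v+e) (≤-trans (m≤m+n v L) (≤-trans (n≤1+n _) (m≤m+n _ (2 * L)))))

colPath-cong : ∀ {a a′ b b′ c c′} → a ≡ a′ → b ≡ b′ → c ≡ c′ → colPath a b c ≡ colPath a′ b′ c′
colPath-cong refl refl refl = refl

columns⇒regionA : ∀ {K e a b c u v} → Columns K e a b c u v → K + e ≤ u → Region K e (colPath a b c)
columns⇒regionA {K} {e} {a} {b} {c} {u} {v} cols K+e≤u =
  subst (Region K e) (colPath-cong (sym a≡) refl refl) (regionA c₀ b c (trans (sym col₃) (cong (_+ c) v≡)))
  where
  open Columns cols
  c₀ = proj₁ (m≤n⇒∃[o]m+o≡n K+e≤u)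
  a≡ : a ≡ suc K + (K + e + c₀)
  a≡ = trans col₁ (cong (suc K +_) (sym (proj₂ (m≤n⇒∃[o]m+o≡n K+e≤u))))
  v≡ : v ≡ c₀ + b
  v≡ = +-cancelˡ-≡ (suc (2 * K + e)) v (c₀ + b) (trans (sym col₂) (trans (cong (_+ b) a≡) (eq K e c₀ b)))
    where
    eq : ∀ K e c₀ b → suc K + (K + e + c₀) + b ≡ suc (2 * K + e) + (c₀ + b)
    eq = solve-∀

columns⇒regionB : ∀ {K e a b c u v} → Columns K e a b c u v → u < K + e → v + e ≤ u → Region K e (colPath a b c)
columns⇒regionB {K} {e} {a} {b} {c} {u} {v} cols u<K+e v+e≤u =
  subst (Region K e) (colPath-cong (sym a≡) (sym b≡) (sym c≡)) (regionB v x y K≡)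
  where
  open Columns cols
  x = proj₁ (m≤n⇒∃[o]m+o≡n v+e≤u)
  u≡ : v + x + e ≡ u
  u≡ = trans (eq v x e) (proj₂ (m≤n⇒∃[o]m+o≡n v+e≤u))
    where eq : ∀ v x e → v + x + e ≡ v + e + x ; eq = solve-∀
  y = proj₁ (m≤n⇒∃[o]m+o≡n u<K+e)
  K≡ : K ≡ v + x + suc y
  K≡ = +-cancelʳ-≡ e K (v + x + suc y)
    (trans (sym (proj₂ (m≤n⇒∃[o]m+o≡n u<K+e))) (trans (cong (λ w → suc w + y) (sym u≡)) (eq v x y e)))
    where eq : ∀ v x y e → suc (v + x + e) + y ≡ v + x + suc y + e ; eq = solve-∀
  a≡ : a ≡ suc K + (v + x + e)
  a≡ = trans col₁ (cong (suc K +_) (sym u≡))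
  b≡ : b ≡ v + suc y
  b≡ = +-cancelˡ-≡ (suc K + (v + x + e)) b (v + suc y) (begin
    suc K + (v + x + e) + b                  ≡⟨ cong (_+ b) a≡ ⟨
    a + b                                    ≡⟨ col₂ ⟩
    suc (2 * K + e) + v                      ≡⟨ cong (λ k → suc (2 * k + e) + v) K≡ ⟩
    suc (2 * (v + x + suc y) + e) + v        ≡⟨ eq v x y e ⟩
    suc (v + x + suc y) + (v + x + e) + (v + suc y) ≡⟨ cong (λ k → suc k + (v + x + e) + (v + suc y)) K≡ ⟨
    suc K + (v + x + e) + (v + suc y)        ∎)
    where
    open ≡-Reasoning
    eq : ∀ v x y e → suc (2 * (v + x + suc y) + e) + v ≡ suc (v + x + suc y) + (v + x + e) + (v + suc y)
    eq = solve-∀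
  c≡ : c ≡ x + suc y
  c≡ = +-cancelˡ-≡ v c (x + suc y) (trans col₃ (trans K≡ (+-assoc v x (suc y))))

columns⇒regionC : ∀ {K e a b c u v} → Columns K e a b c u v → u < v + e → Region K e (colPath a b c)
columns⇒regionC {K} {e} {a} {b} {c} {u} {v} cols u<v+e =
  subst (Region K e) (colPath-cong (sym col₁) (sym b≡) refl) (regionC u v z c u+z+1≡v+e (sym col₃))
  where
  open Columns cols
  z = proj₁ (m≤n⇒∃[o]m+o≡n u<v+e)
  u+z+1≡v+e : u + suc z ≡ v + e
  u+z+1≡v+e = trans (+-suc u z) (proj₂ (m≤n⇒∃[o]m+o≡n u<v+e))
  b≡ : b ≡ suc K + z
  b≡ = +-cancelˡ-≡ (suc K + u) b (suc K + z)
    (trans (cong (_+ b) (sym col₁)) (trans col₂ (sym (Columns.col₂ (columns-C u v z c u+z+1≡v+e col₃)))))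

region-of-columns : ∀ {K e a b c u v} → Columns K e a b c u v → Region K e (colPath a b c)
region-of-columns {K} {e} {u = u} {v} cols with K + e ≤? u | v + e ≤? u
... | yes K+e≤u | _         = columns⇒regionA cols K+e≤u
... | no  K+e≰u | yes v+e≤u = columns⇒regionB cols (≰⇒> K+e≰u) v+e≤u
... | no  _     | no  v+e≰u = columns⇒regionC cols (≰⇒> v+e≰u)

classify : ∀ {K e} → e ≤ 1 → ∀ p → T (isDyck (3 * K + 1 + e) p) → Region K e p
classify {K} {e} e≤1 p t with Decomposition.dyck⇒columns K e e≤1 p t
... | a , b , c , u , v , refl , cols = region-of-columns cols

dinvA≢dinvBC : ∀ {K} c w L m → K ≡ c + w + L → w + L ≢ suc K + m
dinvA≢dinvBC {K} c w L m K≡ eq = <-irrefl refl (begin-strict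
  w + L       ≤⟨ m+k≡n⇒m≤n c (trans (+-comm (w + L) c) (trans (sym (+-assoc c w L)) (sym K≡))) ⟩
  K           <⟨ n<1+n K ⟩
  suc K       ≤⟨ m≤m+n (suc K) m ⟩
  suc K + m   ≡⟨ eq ⟨
  w + L       ∎)
  where open ≤-Reasoning

2*-injective : ∀ {m n} → 2 * m ≡ 2 * n → m ≡ n
2*-injective {m} {n} = *-cancelˡ-≡ m n 2

region-injective : ∀ {K e p p′} (R : Region K e p) (R′ : Region K e p′) →
  regionDinv R ≡ regionDinv R′ → regionSkip R ≡ regionSkip R′ → p ≡ p′
region-injective {K} {e} (regionA c w L K≡) (regionA c′ w′ L′ K≡′) d≡ refl =
  colPath-cong (cong (λ c → suc K + (K + e + c)) c≡) w≡ (refl {x = L})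
  where
  w≡ : w ≡ w′
  w≡ = +-cancelʳ-≡ L w w′ d≡
  c≡ : c ≡ c′
  c≡ = +-cancelʳ-≡ L c c′ (+-cancelʳ-≡ w (c + L) (c′ + L) (begin
    c + L + w      ≡⟨ eq c w L ⟨
    c + w + L      ≡⟨ trans (sym K≡) K≡′ ⟩
    c′ + w′ + L    ≡⟨ eq c′ w′ L ⟩
    c′ + L + w′    ≡⟨ cong (c′ + L +_) w≡ ⟨
    c′ + L + w     ∎))
    where
    open ≡-Reasoning
    eq : ∀ c w L → c + w + L ≡ c + L + w
    eq = solve-∀
region-injective (regionA c w L K≡) (regionB v x y _) d≡ _ = ⊥-elim (dinvA≢dinvBC c w L _ K≡ d≡)
region-injective (regionA c w L K≡) (regionC u v z L′ _ _) d≡ _ = ⊥-elim (dinvA≢dinvBC c w L _ K≡ d≡)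
region-injective (regionB v x y _) (regionA c w L K≡) d≡ _ = ⊥-elim (dinvA≢dinvBC c w L _ K≡ (sym d≡))
region-injective (regionC u v z L _ _) (regionA c w L′ K≡) d≡ _ = ⊥-elim (dinvA≢dinvBC c w L′ _ K≡ (sym d≡))
region-injective {K} (regionB v x y _) (regionC u v′ z L _ _) d≡ _ =
  ⊥-elim (even≢odd L y (sym (+-cancelˡ-≡ (suc K) _ _ d≡)))
region-injective {K} (regionC u v z L _ _) (regionB v′ x y _) d≡ _ =
  ⊥-elim (even≢odd L y (+-cancelˡ-≡ (suc K) _ _ d≡))
region-injective {K} {e} (regionB v x y K≡) (regionB v′ x′ y′ K≡′) d≡ refl =
  colPath-cong (cong (λ v → suc K + (v + x + e)) v≡) (cong₂ (λ v y → v + suc y) v≡ y≡) (cong (λ y → x + suc y) y≡)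
  where
  y≡ : y ≡ y′
  y≡ = 2*-injective (suc-injective (+-cancelˡ-≡ (suc K) _ _ d≡))
  v≡ : v ≡ v′
  v≡ = +-cancelʳ-≡ x v v′ (+-cancelʳ-≡ (suc y) (v + x) (v′ + x)
    (trans (sym K≡) (trans K≡′ (cong (λ y → v′ + x + suc y) (sym y≡)))))
region-injective {K} {e} (regionC u v z L u+z+1≡v+e K≡) (regionC u′ v′ z′ L′ u+z+1≡v+e′ K≡′) d≡ refl =
  colPath-cong (cong (suc K +_) u≡) (refl {x = suc K + z}) L≡
  where
  L≡ : L ≡ L′
  L≡ = 2*-injective (+-cancelˡ-≡ (suc K) _ _ d≡)
  v≡ : v ≡ v′
  v≡ = +-cancelʳ-≡ L v v′ (trans (sym K≡) (trans K≡′ (cong (v′ +_) (sym L≡))))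
  u≡ : u ≡ u′
  u≡ = +-cancelʳ-≡ (suc z) u u′ (trans u+z+1≡v+e (trans (cong (_+ e) v≡) (sym u+z+1≡v+e′)))

even⊎odd : ∀ m → Σ ℕ λ y → m ≡ 2 * y ⊎ m ≡ suc (2 * y)
even⊎odd zero          = 0 , inj₁ refl
even⊎odd (suc zero)    = 0 , inj₂ refl
even⊎odd (suc (suc m)) with even⊎odd m
... | y , inj₁ m≡ = suc y , inj₁ (trans (cong (2 +_) m≡) (sym (*-suc 2 y)))
... | y , inj₂ m≡ = suc y , inj₂ (cong suc (trans (cong (1 +_) m≡) (sym (*-suc 2 y))))

half-≤ : ∀ {e X K} → e ≤ 1 → 2 * X ≤ 2 * K + e → X ≤ K
half-≤ {X = X} {K} z≤n       2X≤2K+e = *-cancelˡ-≤ 2 (subst (2 * X ≤_) (+-identityʳ (2 * K)) 2X≤2K+e)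
half-≤ {X = X} {K} (s≤s z≤n) 2X≤2K+e = ≤-pred (*-cancelˡ-< 2 X (suc K)
  (subst (2 * X <_) (sym (*-suc 2 K)) (s≤s (subst (2 * X ≤_) (+-comm (2 * K) 1) 2X≤2K+e))))

half-< : ∀ {e X K} → e ≤ 1 → suc (2 * X) ≤ 2 * K + e → X < K + e
half-< {X = X} {K} z≤n       2X<2K+e = subst (X <_) (sym (+-identityʳ K))
  (*-cancelˡ-< 2 X K (subst (2 * X <_) (+-identityʳ (2 * K)) 2X<2K+e))
half-< {X = X} {K} (s≤s z≤n) 2X<2K+e = subst (X <_) (+-comm 1 K)
  (s≤s (*-cancelˡ-≤ 2 (≤-pred (subst (suc (2 * X) ≤_) (+-comm (2 * K) 1) 2X<2K+e))))

Realisation : ℕ → ℕ → ℕ → ℕ → Set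
Realisation K e d s = Σ (List Step) λ p → Σ (Region K e p) λ R → regionDinv R ≡ d × regionSkip R ≡ s

realise-A : ∀ {K e} d s → s ≤ d → d ≤ K → Realisation K e d s
realise-A {K} d s s≤d d≤K = _ , regionA c w s K≡ , trans (+-comm w s) s+w≡d , refl
  where
  c = proj₁ (m≤n⇒∃[o]m+o≡n d≤K)
  w = proj₁ (m≤n⇒∃[o]m+o≡n s≤d)
  s+w≡d : s + w ≡ d
  s+w≡d = proj₂ (m≤n⇒∃[o]m+o≡n s≤d)
  K≡ : K ≡ c + w + s
  K≡ = trans (sym (proj₂ (m≤n⇒∃[o]m+o≡n d≤K))) (trans (cong (_+ c) (sym s+w≡d)) (eq s w c))
    where eq : ∀ s w c → s + w + c ≡ c + w + s ; eq = solve-∀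

realise-B : ∀ {K e} → e ≤ 1 → ∀ y s → s + (s + (suc K + suc (2 * y))) ≤ 3 * K + e →
  Realisation K e (suc K + suc (2 * y)) s
realise-B {K} {e} e≤1 y s bound = _ , regionB v s y K≡ , refl , refl
  where
  s+y+1≤K : s + suc y ≤ K
  s+y+1≤K = half-≤ e≤1 (+-cancelˡ-≤ K _ _ (subst₂ _≤_ (eq₁ K s y) (eq₂ K e) bound))
    where
    eq₁ : ∀ K s y → s + (s + (suc K + suc (2 * y))) ≡ K + 2 * (s + suc y)
    eq₁ = solve-∀
    eq₂ : ∀ K e → 3 * K + e ≡ K + (2 * K + e)
    eq₂ = solve-∀
  v = proj₁ (m≤n⇒∃[o]m+o≡n s+y+1≤K)
  K≡ : K ≡ v + s + suc y
  K≡ = trans (sym (proj₂ (m≤n⇒∃[o]m+o≡n s+y+1≤K))) (eq s y v)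
    where eq : ∀ s y v → s + suc y + v ≡ v + s + suc y ; eq = solve-∀

realise-C : ∀ {K e} → e ≤ 1 → ∀ L s → s + (s + (suc K + 2 * L)) ≤ 3 * K + e →
  Realisation K e (suc K + 2 * L) s
realise-C {K} {e} e≤1 L s bound = _ , regionC u v s L u+s+1≡v+e (trans (sym L+v≡K) (+-comm L v)) , refl , refl
  where
  s+L<K+e : s + L < K + e
  s+L<K+e = half-< e≤1 (+-cancelˡ-≤ K _ _ (subst₂ _≤_ (eq₁ K s L) (eq₂ K e) bound))
    where
    eq₁ : ∀ K s L → s + (s + (suc K + 2 * L)) ≡ K + suc (2 * (s + L))
    eq₁ = solve-∀
    eq₂ : ∀ K e → 3 * K + e ≡ K + (2 * K + e)
    eq₂ = solve-∀
  L≤K : L ≤ K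
  L≤K = ≤-trans (m≤n+m L s) (≤-pred (≤-trans s+L<K+e (≤-trans (+-monoʳ-≤ K e≤1) (≤-reflexive (+-comm K 1)))))
  v = proj₁ (m≤n⇒∃[o]m+o≡n L≤K)
  L+v≡K : L + v ≡ K
  L+v≡K = proj₂ (m≤n⇒∃[o]m+o≡n L≤K)
  u = proj₁ (m≤n⇒∃[o]m+o≡n s+L<K+e)
  u+s+1≡v+e : u + suc s ≡ v + e
  u+s+1≡v+e = +-cancelˡ-≡ L _ _ (begin
    L + (u + suc s)   ≡⟨ eq L u s ⟩
    suc (s + L) + u   ≡⟨ proj₂ (m≤n⇒∃[o]m+o≡n s+L<K+e) ⟩
    K + e             ≡⟨ cong (_+ e) L+v≡K ⟨
    L + v + e         ≡⟨ +-assoc L v e ⟩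
    L + (v + e)       ∎)
    where
    open ≡-Reasoning
    eq : ∀ L u s → L + (u + suc s) ≡ suc (s + L) + u
    eq = solve-∀

realise : ∀ {K e} → e ≤ 1 → ∀ d s → s ≤ d → s + (s + d) ≤ 3 * K + e → Realisation K e d s
realise {K} e≤1 d s s≤d bound with d ≤? K
... | yes d≤K = realise-A d s s≤d d≤K
... | no  d≰K with m≤n⇒∃[o]m+o≡n (≰⇒> d≰K)
...   | m , refl with even⊎odd m
...     | y , inj₂ refl = realise-B e≤1 y s bound
...     | L , inj₁ refl = realise-C e≤1 L s bound


-- The unique swap

Swapping : {X : Set} → (α δ σ : X → ℕ) → (X → X) → Set
Swapping α δ σ φ = ∀ x → (α (φ x) ≡ δ x) × (δ (φ x) ≡ α x) × (σ (φ x) ≡ σ x)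

unique-swap : ∀ {X : Set} (α δ σ : X → ℕ) →
  (∀ x y → δ x ≡ δ y → σ x ≡ σ y → x ≡ y) →
  (∀ x → Σ X λ y → (α y ≡ δ x) × (δ y ≡ α x) × (σ y ≡ σ x)) →
  Σ (X → X) λ φ → Bijective _≡_ _≡_ φ × Swapping α δ σ φ ×
    ((ψ : X → X) → Bijective _≡_ _≡_ ψ → Swapping α δ σ ψ → ∀ x → ψ x ≡ φ x)
unique-swap {X} α δ σ determined swap = φ , (injective , surjective) , swapping , unique
  where
  φ : X → X
  φ = proj₁ ∘ swap
  swapping : Swapping α δ σ φ
  swapping = proj₂ ∘ swap
  involutive : ∀ x → φ (φ x) ≡ x
  involutive x = determined (φ (φ x)) x
    (trans (proj₁ (proj₂ (swapping (φ x)))) (proj₁ (swapping x)))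
    (trans (proj₂ (proj₂ (swapping (φ x)))) (proj₂ (proj₂ (swapping x))))
  injective : Injective _≡_ _≡_ φ
  injective {x} {y} φx≡φy = trans (sym (involutive x)) (trans (cong φ φx≡φy) (involutive y))
  surjective : Surjective _≡_ _≡_ φ
  surjective y = φ y , λ z≡φy → trans (cong φ z≡φy) (involutive y)
  unique : (ψ : X → X) → Bijective _≡_ _≡_ ψ → Swapping α δ σ ψ → ∀ x → ψ x ≡ φ x
  unique ψ _ ψ-swaps x = determined (ψ x) (φ x)
    (trans (proj₁ (proj₂ (ψ-swaps x))) (sym (proj₁ (proj₂ (swapping x)))))
    (trans (proj₂ (proj₂ (ψ-swaps x))) (sym (proj₂ (proj₂ (swapping x)))))

DyckPath-≡ : ∀ {n} {Π Π′ : DyckPath n} → proj₁ Π ≡ proj₁ Π′ → Π ≡ Π′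
DyckPath-≡ {Π = p , t} {.p , t′} refl = cong (p ,_) (T-irrelevant t t′)

module _ {K e : ℕ} (e≤1 : e ≤ 1) where

  private
    n : ℕ
    n = 3 * K + 1 + e

  region : (Π : DyckPath n) → Region K e (proj₁ Π)
  region (p , t) = classify e≤1 p t

  statistics : (Π : DyckPath n) →
    Statistics n (proj₁ Π) (regionArea (region Π)) (regionDinv (region Π)) (regionSkip (region Π))
  statistics Π = region-statistics e≤1 (region Π)

  area≡ : ∀ Π → area n Π ≡ regionArea (region Π)
  area≡ (p , t) = Statistics.area≡ (statistics (p , t)) t

  dinv≡ : ∀ Π → dinv n Π ≡ regionDinv (region Π)
  dinv≡ (p , t) = Statistics.dinv≡ (statistics (p , t)) t

  skip≡ : ∀ Π → skip n Π ≡ regionSkip (region Π)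
  skip≡ (p , t) = Statistics.skip≡ (statistics (p , t)) t

  dinv-skip-determine : ∀ Π Π′ → dinv n Π ≡ dinv n Π′ → skip n Π ≡ skip n Π′ → Π ≡ Π′
  dinv-skip-determine Π Π′ d≡ s≡ = DyckPath-≡ (region-injective (region Π) (region Π′)
    (trans (sym (dinv≡ Π)) (trans d≡ (dinv≡ Π′)))
    (trans (sym (skip≡ Π)) (trans s≡ (skip≡ Π′))))

  statistics-sum : ∀ Π → area n Π + (dinv n Π + skip n Π) ≡ 3 * K + e
  statistics-sum Π = trans (cong₂ _+_ (area≡ Π) (cong₂ _+_ (dinv≡ Π) (skip≡ Π))) (region-sum (region Π))

  skip≤area : ∀ Π → skip n Π ≤ area n Π
  skip≤area Π = subst₂ _≤_ (sym (skip≡ Π)) (sym (area≡ Π)) (region-skip≤area e≤1 (region Π))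

  skip≤dinv : ∀ Π → skip n Π ≤ dinv n Π
  skip≤dinv Π = subst₂ _≤_ (sym (skip≡ Π)) (sym (dinv≡ Π)) (region-skip≤dinv e≤1 (region Π))

  swap-realised : ∀ Π → Σ (DyckPath n) λ Π′ →
    (area n Π′ ≡ dinv n Π) × (dinv n Π′ ≡ area n Π) × (skip n Π′ ≡ skip n Π)
  swap-realised Π with realise {K} e≤1 (area n Π) (skip n Π) (skip≤area Π) bound
    where
    bound : skip n Π + (skip n Π + area n Π) ≤ 3 * K + e
    bound = ≤-trans (+-monoʳ-≤ (skip n Π) (+-monoˡ-≤ (area n Π) (skip≤dinv Π)))
                    (≤-reflexive (trans (eq (skip n Π) (dinv n Π) (area n Π)) (statistics-sum Π)))
      where
      eq : ∀ s d a → s + (d + a) ≡ a + (d + s)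
      eq = solve-∀
  ... | p′ , R′ , d≡ , s≡ =
    (p′ , t′) , area′≡ , trans (Statistics.dinv≡ stats′ t′) d≡ , trans (Statistics.skip≡ stats′ t′) s≡
    where
    t′ = region-isDyck e≤1 R′
    stats′ = region-statistics e≤1 R′
    area′≡ : area n (p′ , t′) ≡ dinv n Π
    area′≡ = +-cancelʳ-≡ (area n Π + skip n Π) _ _ (begin
      area n (p′ , t′) + (area n Π + skip n Π)       ≡⟨ cong (_+ (area n Π + skip n Π)) (Statistics.area≡ stats′ t′) ⟩
      regionArea R′ + (area n Π + skip n Π)          ≡⟨ cong₂ (λ d s → regionArea R′ + (d + s)) d≡ s≡ ⟨
      regionArea R′ + (regionDinv R′ + regionSkip R′) ≡⟨ region-sum R′ ⟩
      3 * K + e                                      ≡⟨ statistics-sum Π ⟨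
      area n Π + (dinv n Π + skip n Π)               ≡⟨ eq (area n Π) (dinv n Π) (skip n Π) ⟩
      dinv n Π + (area n Π + skip n Π)               ∎)
      where
      open ≡-Reasoning
      eq : ∀ a d s → a + (d + s) ≡ d + (a + s)
      eq = solve-∀

not-multiple-of-3 : ∀ n → ¬ (3 ∣ n) → Σ ℕ λ K → Σ ℕ λ e → e ≤ 1 × n ≡ 3 * K + 1 + e
not-multiple-of-3 n 3∤n with n % 3 | m%n<n n 3 | m≡m%n+[m/n]*n n 3
... | 0 | _ | n≡ = ⊥-elim (3∤n (divides (n / 3) n≡))
... | 1 | _ | n≡ = n / 3 , 0 , z≤n , trans n≡ (eq (n / 3))
  where eq : ∀ q → 1 + q * 3 ≡ 3 * q + 1 + 0 ; eq = solve-∀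
... | 2 | _ | n≡ = n / 3 , 1 , s≤s z≤n , trans n≡ (eq (n / 3))
  where eq : ∀ q → 2 + q * 3 ≡ 3 * q + 1 + 1 ; eq = solve-∀
... | suc (suc (suc _)) | s≤s (s≤s (s≤s ())) | _

mainTheorem2 : (n : ℕ) → 1 ≤ n → ¬ (3 ∣ n) →
    Σ (DyckPath n → DyckPath n) (λ φ →
        Bijective _≡_ _≡_ φ
      × Swaps n φ
      × ((ψ : DyckPath n → DyckPath n) → Bijective _≡_ _≡_ ψ → Swaps n ψ →
          (Π : DyckPath n) → ψ Π ≡ φ Π))
-- The hypothesis 1 ≤ n is implied by ¬ 3 ∣ n.
mainTheorem2 n _ 3∤n with not-multiple-of-3 n 3∤n
... | K , e , e≤1 , refl = unique-swap (area n) (dinv n) (skip n) (dinv-skip-determine {K} e≤1) (swap-realised {K} e≤1)
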